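{- Let $q$ be an odd prime, let $r\in[1,q-1]$ be an integer such that $r^2\equiv -1\pmod q$, and let $$G=\langle \alpha,\tau:\ \alpha^q=1,\ \tau^4=1,\ \alpha\tau=\tau\alpha^r\rangle.$$ Then $\mathsf d(G)=q+2$.
   Context: A sequence over a finite group $G$ is a finite unordered list of elements of $G$ with repetition allowed; its length is its number of terms with multiplicity; a subsequence is a sub-multiset. A sequence is product-one if its terms can be ordered so that their product is the identity. The small Davenport constant $\mathsf d(G)$ is the maximal integer $\ell$ such that there is a sequence over $G$ of length $\ell$ having no nonempty product-one subsequence. -}

module Defs where

open import Data.Nat using (ℕ; zero; suc; _+_; _*_; _^_; _<_; NonZero)
open import Data.Nat.DivMod using (_mod_)
open import Data.Fin using (Fin; toℕ)
open import Data.Product using (_×_; _,_; ∃; ∃-syntax)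
open import Data.List using (List; []; _∷_; _++_; length; foldr)
open import Data.List.Relation.Binary.Permutation.Propositional using (_↭_)
open import Relation.Binary.PropositionalEquality using (_≡_)
open import Relation.Nullary using (¬_)

module Sequences {A : Set} (_·_ : A → A → A) (e : A) where

  prod : List A → A
  prod = foldr _·_ e

  -- a sequence (unordered list = list up to permutation) is product-one
  -- if its terms can be ordered so that their product is the identity
  ProductOne : List A → Set
  ProductOne S = ∃[ L ] (L ↭ S × prod L ≡ e)

  SubSeq : List A → List A → Set
  SubSeq T S = ∃[ U ] ((T ++ U) ↭ S)

  ProductOneFree : List A → Set
  ProductOneFree S = ∀ T → SubSeq T S → 0 < length T → ¬ ProductOne T

  IsSmallDavenport : ℕ → Set
  IsSmallDavenport d =
    (∃[ S ] (length S ≡ d × ProductOneFree S)) ×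
    (∀ S → ProductOneFree S → length S Data.Nat.≤ d)

-- The group  G = ⟨ α, τ : α^q = 1, τ^4 = 1, ατ = τα^r ⟩  (r^2 ≡ -1 mod q),
-- realised concretely as the semidirect product C_q ⋊ C_4:
-- the pair (j , i) stands for τ^j α^i, and since α^i τ^b = τ^b α^(i r^b),
--   (τ^a α^i)(τ^b α^k) = τ^(a+b) α^(i r^b + k).

Elem : (q : ℕ) → Set
Elem q = Fin 4 × Fin q

mul : (q r : ℕ) .{{_ : NonZero q}} → Elem q → Elem q → Elem q
mul q r (a , i) (b , k) =
  ((toℕ a + toℕ b) mod 4 , (toℕ i * r ^ toℕ b + toℕ k) mod q)

one : (q : ℕ) .{{_ : NonZero q}} → Elem q
one q = (0 mod 4 , 0 mod q)

{-# OPTIONS --safe #-}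

-- Write τʲαⁱ as (j , i). A product-one subsequence of α^(q−1)τ³ has τ-degree 0 mod 4, so it
-- contains no τ and is a power αᵏ with 0 < k < q: impossible.
--
-- Conversely, a sequence of length at least q + 3 splits, apart from at most three terms, into
-- blocks of shapes τ⁰, τ¹τ³, τ²τ², τ¹τ¹τ², τ³τ³τ², (τ¹)⁴, (τ³)⁴ (each term decorated with some
-- power of α). A block has τ-degree 0 mod 4 and pairwise distinct proper partial τ-degrees mod 4,
-- so if its product is αᵛ, its cyclic rotations have the products α^(rᵏv) for |B| distinct k mod 4.
-- As r has order 4 mod q, these form a set A_B of |B| nonzero residues, unless v ≡ 0 and the block
-- itself is product-one. By Cauchy–Davenport, A_B₁ + (A_B₂ ∪ {0}) + ⋯ + (A_Bₘ ∪ {0}) has at least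
-- min(q, Σ|Bᵢ|) = q elements, so it contains 0, which is the product of a nonempty subsequence
-- made of rotations of some of the blocks.

module Submission where

open import Defs
open import Data.Bool using (Bool; true; false; _∧_; _∨_; not; T)
open import Data.Bool.ListAction using (any)
open import Data.Bool.Properties using (T-∧; T-∨; ∧-comm; ∧-zeroʳ)
open import Data.Empty using (⊥-elim)
open import Data.Fin using (Fin; toℕ)
open import Data.Fin.Patterns using (0F; 1F; 2F; 3F)
open import Data.Fin.Properties using (toℕ-fromℕ<; toℕ-injective)
open import Data.List using (List; []; _∷_; _++_; length; map; take; drop; upTo; replicate; concat; concatMap)
open import Data.List.Membership.Propositional using (_∈_; find)
open import Data.List.Membership.Propositional.Properties using (∈-map⁻)
open import Data.List.Properties
  using (++-assoc; ++-identityʳ; length-++; length-map; length-replicate; length-upTo; map-++; concat-++; take++drop≡id)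
open import Data.List.Relation.Binary.Permutation.Propositional
  using (_↭_; ↭-refl; ↭-sym; ↭-trans; ↭-reflexive; prep; module PermutationReasoning)
open import Data.List.Relation.Binary.Permutation.Propositional.Properties
  using (++⁺ˡ; ++⁺ʳ; ++⁺; shift; shifts; ++-comm; ∷↭∷ʳ; ↭-length; All-resp-↭; map⁺)
open import Data.List.Relation.Unary.All as All using (All; []; _∷_)
import Data.List.Relation.Unary.All.Properties as All
open import Data.List.Relation.Unary.All.Properties using (All¬⇒¬Any; ¬Any⇒All¬)
open import Data.List.Relation.Unary.AllPairs as AllPairs using ()
import Data.List.Relation.Unary.AllPairs.Properties as AllPairs
open import Data.List.Relation.Unary.Any as Any using (Any; here; there; any?)
open import Data.List.Relation.Unary.Any.Properties using (any⁻)
open import Data.List.Relation.Unary.Unique.Propositional using (Unique)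
open import Data.Nat
open import Data.Nat.Coprimality using (Coprime; prime⇒coprime; coprime-Bézout)
open import Data.Nat.Divisibility
open import Data.Nat.DivMod
open import Data.Nat.GCD using (module Bézout)
open import Data.Nat.ListAction using (sum)
open import Data.Nat.ListAction.Properties using (sum-++; sum-↭)
open import Data.Nat.Primality
open import Data.Nat.Properties
open import Algebra.Properties.CommutativeSemigroup +-commutativeSemigroup
  using (interchange; xy∙z≈xz∙y; x∙yz≈y∙xz)
open import Data.Nat.Tactic.RingSolver using (solve-∀)
open import Data.List.Relation.Unary.Unique.DecPropositional _≟_ using (unique?)
open import Data.Product using (_×_; _,_; ∃-syntax; proj₁; proj₂)
open import Data.Sum using (_⊎_; inj₁; inj₂)
open import Data.Unit using (tt)
open import Function using (_∘_)
open import Function.Bundles using (Equivalence)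
open import Relation.Binary.Definitions using (tri<; tri≈; tri>)
open import Relation.Binary.PropositionalEquality
open import Relation.Nullary using (¬_; yes; no)
open import Relation.Nullary.Decidable using (True; ⌊_⌋; toWitness; fromWitness; toWitnessFalse; fromWitnessFalse; T?)

open Equivalence using (to; from)

-- Arithmetic modulo n

0%n≡0 : ∀ n .{{_ : NonZero n}} → 0 % n ≡ 0
0%n≡0 (suc n) = refl

module Congruence (n : ℕ) .{{_ : NonZero n}} where

  infix 4 _≈_
  _≈_ : ℕ → ℕ → Set
  a ≈ b = a % n ≡ b % n

  ≡⇒≈ : ∀ {a b} → a ≡ b → a ≈ b
  ≡⇒≈ = cong (_% n)

  %-≈ : ∀ a → a % n ≈ a
  %-≈ a = m%n%n≡m%n a n

  ≈-+ : ∀ {a b c d} → a ≈ b → c ≈ d → a + c ≈ b + d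
  ≈-+ {a} {b} {c} {d} a≈b c≈d = begin
    (a + c) % n              ≡⟨ %-distribˡ-+ a c n ⟩
    (a % n + c % n) % n      ≡⟨ cong₂ (λ x y → (x + y) % n) a≈b c≈d ⟩
    (b % n + d % n) % n      ≡⟨ %-distribˡ-+ b d n ⟨
    (b + d) % n              ∎
    where open ≡-Reasoning

  ≈-* : ∀ {a b c d} → a ≈ b → c ≈ d → a * c ≈ b * d
  ≈-* {a} {b} {c} {d} a≈b c≈d = begin
    (a * c) % n              ≡⟨ %-distribˡ-* a c n ⟩
    (a % n * (c % n)) % n    ≡⟨ cong₂ (λ x y → (x * y) % n) a≈b c≈d ⟩
    (b % n * (d % n)) % n    ≡⟨ %-distribˡ-* b d n ⟨
    (b * d) % n              ∎
    where open ≡-Reasoning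

  ≈-+ˡ : ∀ c {a b} → a ≈ b → c + a ≈ c + b
  ≈-+ˡ c = ≈-+ {c} refl

  ≈-+ʳ : ∀ c {a b} → a ≈ b → a + c ≈ b + c
  ≈-+ʳ c a≈b = ≈-+ a≈b (refl {x = c % n})

  ≈-*ˡ : ∀ c {a b} → a ≈ b → c * a ≈ c * b
  ≈-*ˡ c = ≈-* {c} refl

  ≈-^ : ∀ {a b} k → a ≈ b → a ^ k ≈ b ^ k
  ≈-^ zero    _   = refl
  ≈-^ (suc k) a≈b = ≈-* a≈b (≈-^ k a≈b)

  +-multiple-≈ : ∀ a k → a + k * n ≈ a
  +-multiple-≈ a k = [m+kn]%n≡m%n a k n

  multiple-≈0 : ∀ k → k * n ≈ 0
  multiple-≈0 k = +-multiple-≈ 0 k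

  -- a representative of − b; the truncated subtraction never truncates since b % n ≤ n
  negate : ℕ → ℕ
  negate b = n ∸ b % n

  +-negate-+-≈ : ∀ a b → a + negate b + b ≈ a
  +-negate-+-≈ a b = begin
    (a + negate b + b) % n        ≡⟨ ≈-+ˡ (a + negate b) (sym (%-≈ b)) ⟩
    (a + negate b + b % n) % n    ≡⟨ cong (_% n) (+-assoc a (negate b) (b % n)) ⟩
    (a + (negate b + b % n)) % n  ≡⟨ cong (λ x → (a + x) % n) (m∸n+n≡m (m%n≤n b n)) ⟩
    (a + n) % n                   ≡⟨ [m+n]%n≡m%n a n ⟩
    a % n                         ∎
    where open ≡-Reasoning

  +-+-negate-≈ : ∀ a b → a + b + negate b ≈ a
  +-+-negate-≈ a b = trans (≡⇒≈ (xy∙z≈xz∙y a b (negate b))) (+-negate-+-≈ a b)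

  ≈-cancelʳ-+ : ∀ c {a b} → a + c ≈ b + c → a ≈ b
  ≈-cancelʳ-+ c {a} {b} eq = begin
    a % n                     ≡⟨ +-+-negate-≈ a c ⟨
    (a + c + negate c) % n    ≡⟨ ≈-+ʳ (negate c) eq ⟩
    (b + c + negate c) % n    ≡⟨ +-+-negate-≈ b c ⟩
    b % n                     ∎
    where open ≡-Reasoning

  ≈-cancelˡ-+ : ∀ c {a b} → c + a ≈ c + b → a ≈ b
  ≈-cancelˡ-+ c {a} {b} eq =
    ≈-cancelʳ-+ c (trans (≡⇒≈ (+-comm a c)) (trans eq (≡⇒≈ (+-comm c b))))

  ∣⇒≈0 : ∀ {a} → n ∣ a → a ≈ 0
  ∣⇒≈0 {a} n∣a = trans (n∣m⇒m%n≡0 a n n∣a) (sym (0%n≡0 n))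

  ≈0⇒∣ : ∀ {a} → a ≈ 0 → n ∣ a
  ≈0⇒∣ {a} a≈0 = m%n≡0⇒n∣m a n (trans a≈0 (0%n≡0 n))

  ≈⇒≡ : ∀ {a b} → a < n → b < n → a ≈ b → a ≡ b
  ≈⇒≡ a<n b<n a≈b = trans (sym (m<n⇒m%n≡m a<n)) (trans a≈b (m<n⇒m%n≡m b<n))

module PrimeCongruence (p : ℕ) .{{_ : NonZero p}} (p-prime : Prime p) where
  open Congruence p

  ≈0-* : ∀ a b → a * b ≈ 0 → a ≈ 0 ⊎ b ≈ 0
  ≈0-* a b ab≈0 with euclidsLemma a b p-prime (≈0⇒∣ ab≈0)
  ... | inj₁ p∣a = inj₁ (∣⇒≈0 p∣a)
  ... | inj₂ p∣b = inj₂ (∣⇒≈0 p∣b)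

  private
    ≤-cancel : ∀ {c a b} → ¬ (c ≈ 0) → a ≤ b → c * a ≈ c * b → a ≈ b
    ≤-cancel {c} {a} {b} c≉0 a≤b eq with ≈0-* c (b ∸ a) c[b∸a]≈0
      where
      c[b∸a]≈0 : c * (b ∸ a) ≈ 0
      c[b∸a]≈0 = ≈-cancelˡ-+ (c * a) (begin
        (c * a + c * (b ∸ a)) % p  ≡⟨ cong (_% p) (*-distribˡ-+ c a (b ∸ a)) ⟨
        (c * (a + (b ∸ a))) % p    ≡⟨ cong (λ x → (c * x) % p) (m+[n∸m]≡n a≤b) ⟩
        (c * b) % p                ≡⟨ eq ⟨
        (c * a) % p                ≡⟨ cong (_% p) (+-identityʳ (c * a)) ⟨
        (c * a + 0) % p            ∎)
        where open ≡-Reasoning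
    ... | inj₁ c≈0 = ⊥-elim (c≉0 c≈0)
    ... | inj₂ b∸a≈0 = sym (begin
      b % p              ≡⟨ cong (_% p) (m+[n∸m]≡n a≤b) ⟨
      (a + (b ∸ a)) % p  ≡⟨ ≈-+ˡ a b∸a≈0 ⟩
      (a + 0) % p        ≡⟨ cong (_% p) (+-identityʳ a) ⟩
      a % p              ∎)
      where open ≡-Reasoning

  ≈-cancelˡ-* : ∀ {c a b} → ¬ (c ≈ 0) → c * a ≈ c * b → a ≈ b
  ≈-cancelˡ-* {c} {a} {b} c≉0 eq with ≤-total a b
  ... | inj₁ a≤b = ≤-cancel c≉0 a≤b eq
  ... | inj₂ b≤a = sym (≤-cancel c≉0 b≤a (sym eq))

  inverse : ∀ d → ¬ (d ≈ 0) → ∃[ u ] (d * u ≈ 1)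
  inverse d d≉0 with coprime-Bézout d-coprime
    where
    d%p≢0 : d % p ≢ 0
    d%p≢0 d%p≡0 = d≉0 (trans d%p≡0 (sym (0%n≡0 p)))
    d-coprime : Coprime p (d % p)
    d-coprime = prime⇒coprime p-prime {{≢-nonZero d%p≢0}} (m%n<n d p)
  ... | Bézout.Identity.-+ x y 1+xp≡yd = y , (begin
    (d * y) % p            ≡⟨ ≈-* (sym (%-≈ d)) refl ⟩
    (d % p * y) % p        ≡⟨ cong (_% p) (trans (*-comm (d % p) y) (sym 1+xp≡yd)) ⟩
    (1 + x * p) % p        ≡⟨ +-multiple-≈ 1 x ⟩
    1 % p                  ∎)
    where open ≡-Reasoning
  ... | Bézout.Identity.+- x y 1+yd≡xp = y * (p ∸ 1) , ≈-cancelʳ-+ (p ∸ 1) (begin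
    (d * (y * (p ∸ 1)) + (p ∸ 1)) % p      ≡⟨ ≈-+ʳ (p ∸ 1) (≈-* (sym (%-≈ d)) refl) ⟩
    (d % p * (y * (p ∸ 1)) + (p ∸ 1)) % p  ≡⟨ cong (_% p) (factor (d % p) y (p ∸ 1)) ⟩
    ((1 + y * (d % p)) * (p ∸ 1)) % p      ≡⟨ cong (λ t → (t * (p ∸ 1)) % p) 1+yd≡xp ⟩
    (x * p * (p ∸ 1)) % p                  ≡⟨ cong (_% p) (swap x p (p ∸ 1)) ⟩
    (x * (p ∸ 1) * p) % p                  ≡⟨ multiple-≈0 (x * (p ∸ 1)) ⟩
    0 % p                                  ≡⟨ trans (0%n≡0 p) (sym (n%n≡0 p)) ⟩
    p % p                                  ≡⟨ cong (_% p) (suc-pred p) ⟨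
    (1 + (p ∸ 1)) % p                      ∎)
    where
    open ≡-Reasoning
    factor : ∀ a y m → a * (y * m) + m ≡ (1 + y * a) * m
    factor = solve-∀
    swap : ∀ x p m → x * p * m ≡ x * m * p
    swap = solve-∀

-- Counting subsets of {0, …, n − 1}

¬T⇒T-not : ∀ {b} → ¬ T b → T (not b)
¬T⇒T-not {true}  ¬b = ¬b tt
¬T⇒T-not {false} _  = tt

T-not⇒¬T : ∀ {b} → T (not b) → ¬ T b
T-not⇒¬T {true} ()

fromBool : Bool → ℕ
fromBool true  = 1
fromBool false = 0

count : (ℕ → Bool) → ℕ → ℕ
count X zero    = 0
count X (suc n) = count X n + fromBool (X n)

anyBelow : (ℕ → Bool) → ℕ → Bool
anyBelow X zero    = false
anyBelow X (suc n) = anyBelow X n ∨ X n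

fromBool-mono : ∀ {a b} → (T a → T b) → fromBool a ≤ fromBool b
fromBool-mono {true}  {true}  _   = ≤-refl
fromBool-mono {true}  {false} a⇒b = ⊥-elim (a⇒b tt)
fromBool-mono {false} _           = z≤n

fromBool-∨-∧ : ∀ a b → fromBool (a ∨ b) + fromBool (a ∧ b) ≡ fromBool a + fromBool b
fromBool-∨-∧ true  true  = refl
fromBool-∨-∧ true  false = refl
fromBool-∨-∧ false true  = refl
fromBool-∨-∧ false false = refl

count-cong : ∀ X Y n → (∀ z → z < n → X z ≡ Y z) → count X n ≡ count Y n
count-cong X Y zero    _   = refl
count-cong X Y (suc n) X≡Y =
  cong₂ _+_ (count-cong X Y n (λ z z<n → X≡Y z (m<n⇒m<1+n z<n))) (cong fromBool (X≡Y n ≤-refl))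

count-mono : ∀ X Y n → (∀ z → z < n → T (X z) → T (Y z)) → count X n ≤ count Y n
count-mono X Y zero    _   = z≤n
count-mono X Y (suc n) X⊆Y =
  +-mono-≤ (count-mono X Y n (λ z z<n → X⊆Y z (m<n⇒m<1+n z<n))) (fromBool-mono (X⊆Y n ≤-refl))

count-mono-< : ∀ X Y n → (∀ z → z < n → T (X z) → T (Y z)) →
               ∀ w → w < n → T (Y w) → ¬ T (X w) → count X n < count Y n
count-mono-< X Y (suc n) X⊆Y w w<1+n Yw ¬Xw with w ≟ n
... | no w≢n = +-mono-<-≤
  (count-mono-< X Y n (λ z z<n → X⊆Y z (m<n⇒m<1+n z<n)) w (≤∧≢⇒< (s≤s⁻¹ w<1+n) w≢n) Yw ¬Xw)
  (fromBool-mono (X⊆Y n ≤-refl))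
... | yes refl with X w | Y w
...   | true  | _    = ⊥-elim (¬Xw tt)
...   | false | true = begin-strict
  count X w + 0   ≡⟨ +-identityʳ _ ⟩
  count X w       ≤⟨ count-mono X Y w (λ z z<w → X⊆Y z (m<n⇒m<1+n z<w)) ⟩
  count Y w       <⟨ n<1+n _ ⟩
  suc (count Y w) ≡⟨ +-comm 1 _ ⟩
  count Y w + 1   ∎
  where open ≤-Reasoning

count-true : ∀ n → count (λ _ → true) n ≡ n
count-true zero    = refl
count-true (suc n) = trans (cong (_+ 1) (count-true n)) (+-comm n 1)

count-false : ∀ n → count (λ _ → false) n ≡ 0
count-false zero    = refl
count-false (suc n) = trans (+-identityʳ _) (count-false n)

count-full : ∀ X n → n ≤ count X n → ∀ z → z < n → T (X z)
count-full X n n≤count z z<n with X z in Xz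
... | true  = tt
... | false = <⇒≱ count<n n≤count
  where
  count<n : count X n < n
  count<n = subst (count X n <_) (count-true n)
    (count-mono-< X (λ _ → true) n (λ _ _ _ → tt) z z<n tt (subst T Xz))

count-∨-∧ : ∀ X Y n →
  count (λ z → X z ∨ Y z) n + count (λ z → X z ∧ Y z) n ≡ count X n + count Y n
count-∨-∧ X Y zero    = refl
count-∨-∧ X Y (suc n) = begin
  (∨n + fromBool (X n ∨ Y n)) + (∧n + fromBool (X n ∧ Y n))
    ≡⟨ interchange ∨n _ ∧n _ ⟩
  (∨n + ∧n) + (fromBool (X n ∨ Y n) + fromBool (X n ∧ Y n))
    ≡⟨ cong₂ _+_ (count-∨-∧ X Y n) (fromBool-∨-∧ (X n) (Y n)) ⟩
  (count X n + count Y n) + (fromBool (X n) + fromBool (Y n))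
    ≡⟨ interchange (count X n) _ _ _ ⟩
  (count X n + fromBool (X n)) + (count Y n + fromBool (Y n)) ∎
  where
  open ≡-Reasoning
  ∨n ∧n : ℕ
  ∨n = count (λ z → X z ∨ Y z) n
  ∧n = count (λ z → X z ∧ Y z) n

count>0⇒witness : ∀ X n → 1 ≤ count X n → ∃[ z ] (z < n × T (X z))
count>0⇒witness X (suc n) 1≤count with X n in Xn
... | true  = n , ≤-refl , subst T (sym Xn) tt
... | false with count>0⇒witness X n (≤-trans 1≤count (≤-reflexive (+-identityʳ _)))
...   | z , z<n , Xz = z , m<n⇒m<1+n z<n , Xz

witness⇒count>0 : ∀ X n z → z < n → T (X z) → 1 ≤ count X n
witness⇒count>0 X (suc n) z z<1+n Xz with z ≟ n
... | no z≢n = ≤-trans (witness⇒count>0 X n z (≤∧≢⇒< (s≤s⁻¹ z<1+n) z≢n) Xz) (m≤m+n _ _)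
... | yes refl with X z
...   | true = m≤n+m 1 (count X z)

anyBelow-sound : ∀ X n → T (anyBelow X n) → ∃[ z ] (z < n × T (X z))
anyBelow-sound X (suc n) any with to T-∨ any
... | inj₂ Xn = n , ≤-refl , Xn
... | inj₁ any′ with anyBelow-sound X n any′
...   | z , z<n , Xz = z , m<n⇒m<1+n z<n , Xz

anyBelow-complete : ∀ X n z → z < n → T (X z) → T (anyBelow X n)
anyBelow-complete X (suc n) z z<1+n Xz with z ≟ n
... | yes refl = from T-∨ (inj₂ Xz)
... | no z≢n   = from T-∨ (inj₁ (anyBelow-complete X n z (≤∧≢⇒< (s≤s⁻¹ z<1+n) z≢n) Xz))

singleton : ℕ → ℕ → Bool
singleton v z = ⌊ z ≟ v ⌋

count-singleton≤1 : ∀ v n → count (singleton v) n ≤ 1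
count-singleton≤1 v zero    = z≤n
count-singleton≤1 v (suc n) with n ≟ v
... | no _     = ≤-trans (≤-reflexive (+-identityʳ _)) (count-singleton≤1 v n)
... | yes refl = ≤-reflexive (cong (_+ 1) (count-below v v ≤-refl))
  where
  count-below : ∀ v m → m ≤ v → count (singleton v) m ≡ 0
  count-below v zero    _   = refl
  count-below v (suc m) m<v with m ≟ v
  ... | yes m≡v = ⊥-elim (<⇒≢ m<v m≡v)
  ... | no _    = trans (+-identityʳ _) (count-below v m (<⇒≤ m<v))

count-singleton : ∀ v n → v < n → count (singleton v) n ≡ 1
count-singleton v n v<n =
  ≤-antisym (count-singleton≤1 v n) (witness⇒count>0 (singleton v) n v v<n (fromWitness refl))

count-suc : ∀ X n → count (λ z → X (suc z)) n + fromBool (X 0) ≡ count X (suc n)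
count-suc X zero    = refl
count-suc X (suc n) = begin
  count X′ n + fromBool (X (suc n)) + fromBool (X 0)  ≡⟨ xy∙z≈xz∙y (count X′ n) _ _ ⟩
  count X′ n + fromBool (X 0) + fromBool (X (suc n))  ≡⟨ cong (_+ fromBool (X (suc n))) (count-suc X n) ⟩
  count X (suc n) + fromBool (X (suc n))             ∎
  where
  open ≡-Reasoning
  X′ : ℕ → Bool
  X′ z = X (suc z)

count-rotate : ∀ n .{{_ : NonZero n}} X → count (λ z → X (suc z % n)) n ≡ count X n
count-rotate n@(suc m) X = begin
  count (λ z → X (suc z % n)) m + fromBool (X (n % n))
    ≡⟨ cong₂ _+_ (count-cong _ _ m (λ z z<m → cong X (m<n⇒m%n≡m (s<s z<m)))) (cong (λ t → fromBool (X t)) (n%n≡0 n)) ⟩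
  count (λ z → X (suc z)) m + fromBool (X 0)
    ≡⟨ count-suc X m ⟩
  count X n ∎
  where open ≡-Reasoning

count-translate : ∀ n .{{_ : NonZero n}} X k → count (λ z → X ((z + k) % n)) n ≡ count X n
count-translate n X zero = count-cong _ _ n (λ z z<n → cong X (trans (cong (_% n) (+-identityʳ z)) (m<n⇒m%n≡m z<n)))
count-translate n X (suc k) = begin
  count (λ z → X ((z + suc k) % n)) n      ≡⟨ count-cong _ _ n (λ z _ → cong X (step z)) ⟩
  count (λ z → X ((suc z % n + k) % n)) n  ≡⟨ count-rotate n (λ w → X ((w + k) % n)) ⟩
  count (λ w → X ((w + k) % n)) n          ≡⟨ count-translate n X k ⟩
  count X n                                ∎
  where
  open ≡-Reasoning
  open Congruence n
  step : ∀ z → (z + suc k) % n ≡ (suc z % n + k) % n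
  step z = trans (cong (_% n) (+-suc z k)) (sym (≈-+ʳ k (%-≈ (suc z))))

elementOf : List ℕ → ℕ → Bool
elementOf vs z = any (λ v → singleton v z) vs

elementOf-sound : ∀ vs {z} → T (elementOf vs z) → z ∈ vs
elementOf-sound vs z∈vs = Any.map toWitness (any⁻ _ vs z∈vs)

count-elementOf : ∀ vs n → All (_< n) vs → Unique vs → count (elementOf vs) n ≡ length vs
count-elementOf []       n _            _                = count-false n
count-elementOf (v ∷ vs) n (v<n ∷ vs<n) (v∉vs AllPairs.∷ vs-unique) = begin
  count (elementOf (v ∷ vs)) n                                   ≡⟨ +-identityʳ _ ⟨
  count (elementOf (v ∷ vs)) n + 0                               ≡⟨ cong (count (elementOf (v ∷ vs)) n +_) disjoint ⟨
  count (elementOf (v ∷ vs)) n + count (λ z → singleton v z ∧ elementOf vs z) n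
                                                                 ≡⟨ count-∨-∧ (singleton v) (elementOf vs) n ⟩
  count (singleton v) n + count (elementOf vs) n
    ≡⟨ cong₂ _+_ (count-singleton v n v<n) (count-elementOf vs n vs<n vs-unique) ⟩
  suc (length vs)                                                ∎
  where
  open ≡-Reasoning
  v∉ : ¬ T (elementOf vs v)
  v∉ v∈ = All¬⇒¬Any v∉vs (elementOf-sound vs v∈)
  disjoint : count (λ z → singleton v z ∧ elementOf vs z) n ≡ 0
  disjoint = trans (count-cong _ _ n meet-false) (count-false n)
    where
    meet-false : ∀ z → z < n → (singleton v z ∧ elementOf vs z) ≡ false
    meet-false z _ with z ≟ v
    ... | no _     = refl
    ... | yes refl with elementOf vs z in eq
    ...   | true  = ⊥-elim (v∉ (subst T (sym eq) tt))
    ...   | false = refl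

-- Sumsets modulo a prime and the Cauchy–Davenport theorem

module Sumset (q : ℕ) .{{_ : NonZero q}} (q-prime : Prime q) where
  open Congruence q
  open PrimeCongruence q q-prime

  ∣_∣ : (ℕ → Bool) → ℕ
  ∣ X ∣ = count X q

  translate : (ℕ → Bool) → ℕ → ℕ → Bool
  translate X k z = X ((z + k) % q)

  ∣translate∣ : ∀ X k → ∣ translate X k ∣ ≡ ∣ X ∣
  ∣translate∣ = count-translate q

  infixl 6 _⊕_
  _⊕_ : (ℕ → Bool) → (ℕ → Bool) → ℕ → Bool
  (X ⊕ Y) z = anyBelow (λ x → X x ∧ anyBelow (λ y → Y y ∧ ⌊ (x + y) % q ≟ z % q ⌋) q) q

  ⊕-sound : ∀ X Y z → T ((X ⊕ Y) z) →
            ∃[ x ] ∃[ y ] (x < q × y < q × T (X x) × T (Y y) × x + y ≈ z)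
  ⊕-sound X Y z X⊕Yz with anyBelow-sound _ q X⊕Yz
  ... | x , x<q , found-x with to T-∧ found-x
  ... | Xx , any-y with anyBelow-sound _ q any-y
  ... | y , y<q , found-y with to T-∧ found-y
  ... | Yy , x+y≈z = x , y , x<q , y<q , Xx , Yy , toWitness x+y≈z

  ⊕-complete : ∀ X Y {x y z} → x < q → y < q → T (X x) → T (Y y) → x + y ≈ z → T ((X ⊕ Y) z)
  ⊕-complete X Y {x} {y} {z} x<q y<q Xx Yy x+y≈z =
    anyBelow-complete _ q x x<q (from T-∧ (Xx ,
      anyBelow-complete _ q y y<q (from T-∧ (Yy , fromWitness x+y≈z))))

  ∣X∣≤∣X⊕Y∣ : ∀ X Y {y} → y < q → T (Y y) → ∣ X ∣ ≤ ∣ X ⊕ Y ∣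
  ∣X∣≤∣X⊕Y∣ X Y {y} y<q Yy = begin
    ∣ X ∣                      ≡⟨ ∣translate∣ X (negate y) ⟨
    ∣ translate X (negate y) ∣ ≤⟨ count-mono _ _ q X-y⊆X⊕Y ⟩
    ∣ X ⊕ Y ∣                  ∎
    where
    open ≤-Reasoning
    X-y⊆X⊕Y : ∀ z → z < q → T (translate X (negate y) z) → T ((X ⊕ Y) z)
    X-y⊆X⊕Y z _ Xz-y = ⊕-complete X Y (m%n<n _ q) y<q Xz-y Yy
      (trans (≈-+ʳ y (%-≈ _)) (+-negate-+-≈ z y))

  q≤∣X∣ : ∀ X → (∀ z → z < q → T (X z)) → q ≤ ∣ X ∣
  q≤∣X∣ X full = subst (_≤ ∣ X ∣) (count-true q) (count-mono _ X q (λ z z<q _ → full z z<q))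

  second-element : ∀ Y {y₁} → T (Y y₁) → 1 < ∣ Y ∣ → ∃[ y₂ ] (y₂ < q × T (Y y₂) × y₂ ≢ y₁)
  second-element Y {y₁} Yy₁ 1<∣Y∣ with T? (anyBelow other q)
    where
    other : ℕ → Bool
    other z = Y z ∧ not (singleton y₁ z)
  ... | yes some-other with anyBelow-sound _ q some-other
  ...   | y₂ , y₂<q , found with to T-∧ found
  ...     | Yy₂ , y₂≢y₁ = y₂ , y₂<q , Yy₂ , toWitnessFalse y₂≢y₁
  second-element Y {y₁} Yy₁ 1<∣Y∣ | no no-other =
    ⊥-elim (<⇒≱ 1<∣Y∣ (≤-trans (count-mono Y (singleton y₁) q Y⊆y₁) (count-singleton≤1 y₁ q)))
    where
    Y⊆y₁ : ∀ z → z < q → T (Y z) → T (singleton y₁ z)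
    Y⊆y₁ z z<q Yz with z ≟ y₁
    ... | yes _   = tt
    ... | no z≢y₁ = no-other (anyBelow-complete _ q z z<q (from T-∧ (Yz , fromWitnessFalse z≢y₁)))

  closed⇒full : ∀ X {d x₀} → ¬ d ≈ 0 → (∀ x → x < q → T (X x) → T (X ((x + d) % q))) →
                x₀ < q → T (X x₀) → ∀ w → w < q → T (X w)
  closed⇒full X {d} {x₀} d≉0 closed x₀<q Xx₀ w w<q with inverse d d≉0
  ... | u , du≈1 = subst (T ∘ X) x₀+kd≡w (iterate k)
    where
    iterate : ∀ k → T (X ((x₀ + k * d) % q))
    iterate zero    = subst (T ∘ X) (sym (trans (cong (_% q) (+-identityʳ x₀)) (m<n⇒m%n≡m x₀<q))) Xx₀
    iterate (suc k) = subst (T ∘ X) step (closed _ (m%n<n _ q) (iterate k))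
      where
      step : ((x₀ + k * d) % q + d) % q ≡ (x₀ + suc k * d) % q
      step = trans (≈-+ʳ d (%-≈ _)) (cong (_% q) (trans (+-assoc x₀ (k * d) d) (cong (x₀ +_) (+-comm (k * d) d))))
    k : ℕ
    k = u * (w + negate x₀)
    x₀+kd≡w : (x₀ + k * d) % q ≡ w
    x₀+kd≡w = begin
      (x₀ + k * d) % q                ≡⟨ ≈-+ˡ x₀ kd≈m ⟩
      (x₀ + (w + negate x₀)) % q      ≡⟨ cong (_% q) (+-comm x₀ _) ⟩
      (w + negate x₀ + x₀) % q        ≡⟨ +-negate-+-≈ w x₀ ⟩
      w % q                           ≡⟨ m<n⇒m%n≡m w<q ⟩
      w                               ∎
      where
      open ≡-Reasoning
      m : ℕ
      m = w + negate x₀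
      kd≈m : k * d ≈ m
      kd≈m = begin
        (u * m * d) % q  ≡⟨ cong (_% q) (trans (*-comm (u * m) d) (sym (*-assoc d u m))) ⟩
        (d * u * m) % q  ≡⟨ ≈-* du≈1 refl ⟩
        (1 * m) % q      ≡⟨ cong (_% q) (*-identityˡ m) ⟩
        m % q            ∎

  splits : (ℕ → Bool) → (ℕ → Bool) → ℕ → Bool
  splits X Y e = anyBelow (λ y → Y y ∧ translate X e y) q ∧ anyBelow (λ y → Y y ∧ not (translate X e y)) q

  unsplit⇒q≤∣X⊕Y∣ : ∀ X Y {x₀ y₁ y₂} → (∀ e → e < q → ¬ T (splits X Y e)) →
                    x₀ < q → T (X x₀) → y₁ < q → T (Y y₁) → y₂ < q → T (Y y₂) → y₂ ≢ y₁ →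
                    q ≤ ∣ X ⊕ Y ∣
  unsplit⇒q≤∣X⊕Y∣ X Y {x₀} {y₁} {y₂} unsplit x₀<q Xx₀ y₁<q Yy₁ y₂<q Yy₂ y₂≢y₁ =
    q≤∣X∣ (X ⊕ Y) (λ z _ → ⊕-complete X Y (m%n<n _ q) y₁<q (X-full _ (m%n<n _ q)) Yy₁
                       (trans (≈-+ʳ y₁ (%-≈ _)) (+-negate-+-≈ z y₁)))
    where
    transfer : ∀ e → e < q → T (translate X e y₁) → T (translate X e y₂)
    transfer e e<q X[y₁+e] with T? (translate X e y₂)
    ... | yes X[y₂+e] = X[y₂+e]
    ... | no ¬X[y₂+e] = ⊥-elim (unsplit e e<q (from T-∧
          ( anyBelow-complete _ q y₁ y₁<q (from T-∧ (Yy₁ , X[y₁+e]))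
          , anyBelow-complete _ q y₂ y₂<q (from T-∧ (Yy₂ , ¬T⇒T-not ¬X[y₂+e])))))
    d : ℕ
    d = y₂ + negate y₁
    d≉0 : ¬ d ≈ 0
    d≉0 d≈0 = y₂≢y₁ (≈⇒≡ y₂<q y₁<q (begin
      y₂ % q                    ≡⟨ +-negate-+-≈ y₂ y₁ ⟨
      (y₂ + negate y₁ + y₁) % q ≡⟨ ≈-+ʳ y₁ d≈0 ⟩
      (0 + y₁) % q              ∎))
      where open ≡-Reasoning
    closed : ∀ x → x < q → T (X x) → T (X ((x + d) % q))
    closed x x<q Xx = subst (T ∘ X) y₂+e≈x+d (transfer e (m%n<n _ q) (subst (T ∘ X) (sym y₁+e≡x) Xx))
      where
      e : ℕ
      e = (x + negate y₁) % q
      y₁+e≡x : (y₁ + e) % q ≡ x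
      y₁+e≡x = begin
        (y₁ + e) % q                ≡⟨ ≈-+ˡ y₁ (%-≈ _) ⟩
        (y₁ + (x + negate y₁)) % q  ≡⟨ cong (_% q) (x∙yz≈y∙xz y₁ x _) ⟩
        (x + (y₁ + negate y₁)) % q  ≡⟨ cong (_% q) (+-assoc x y₁ _) ⟨
        (x + y₁ + negate y₁) % q    ≡⟨ +-+-negate-≈ x y₁ ⟩
        x % q                       ≡⟨ m<n⇒m%n≡m x<q ⟩
        x                           ∎
        where open ≡-Reasoning
      y₂+e≈x+d : (y₂ + e) % q ≡ (x + d) % q
      y₂+e≈x+d = trans (≈-+ˡ y₂ (%-≈ _)) (cong (_% q) (x∙yz≈y∙xz y₂ x _))
    X-full : ∀ w → w < q → T (X w)
    X-full = closed⇒full X d≉0 closed x₀<q Xx₀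

  record Transform (X Y : ℕ → Bool) : Set where
    field
      X′ Y′     : ℕ → Bool
      ∣X∣≤∣X′∣  : ∣ X ∣ ≤ ∣ X′ ∣
      ∣Y′∣<∣Y∣  : ∣ Y′ ∣ < ∣ Y ∣
      1≤∣Y′∣    : 1 ≤ ∣ Y′ ∣
      ∣X′∣+∣Y′∣ : ∣ X′ ∣ + ∣ Y′ ∣ ≡ ∣ X ∣ + ∣ Y ∣
      X′⊕Y′⊆X⊕Y : ∀ z → z < q → T ((X′ ⊕ Y′) z) → T ((X ⊕ Y) z)

  -- Dyson's e-transform: X′ = X ∪ (Y + e), Y′ = Y ∩ (X − e).
  e-transform : ∀ X Y e → T (splits X Y e) → Transform X Y
  e-transform X Y e split with to T-∧ split
  ... | meets , misses with anyBelow-sound _ q meets | anyBelow-sound _ q misses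
  ... | ya , ya<q , Y∧Xya | yb , yb<q , Y∧¬Xyb with to (T-∧ {Y ya}) Y∧Xya | to (T-∧ {Y yb}) Y∧¬Xyb
  ... | Yya , X[ya+e] | Yyb , ¬X[yb+e] = record
    { X′        = X′
    ; Y′        = Y′
    ; ∣X∣≤∣X′∣  = count-mono X X′ q (λ z _ Xz → from T-∨ (inj₁ Xz))
    ; ∣Y′∣<∣Y∣  = count-mono-< Y′ Y q (λ z _ Y′z → proj₁ (to (T-∧ {Y z}) Y′z)) yb yb<q Yyb
                    (λ Y′yb → T-not⇒¬T ¬X[yb+e] (proj₂ (to (T-∧ {Y yb}) Y′yb)))
    ; 1≤∣Y′∣    = witness⇒count>0 Y′ q ya ya<q (from T-∧ (Yya , X[ya+e]))
    ; ∣X′∣+∣Y′∣ = sizes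
    ; X′⊕Y′⊆X⊕Y = sumset-shrinks
    }
    where
    X′ Y′ : ℕ → Bool
    X′ z = X z ∨ translate Y (negate e) z
    Y′ z = Y z ∧ translate X e z
    -e+e : ∀ z → z < q → ((z + negate e) % q + e) % q ≡ z
    -e+e z z<q = trans (≈-+ʳ e (%-≈ _)) (trans (+-negate-+-≈ z e) (m<n⇒m%n≡m z<q))
    sizes : ∣ X′ ∣ + ∣ Y′ ∣ ≡ ∣ X ∣ + ∣ Y ∣
    sizes = begin
      ∣ X′ ∣ + ∣ Y′ ∣                                          ≡⟨ cong (∣ X′ ∣ +_) (∣translate∣ Y′ (negate e)) ⟨
      ∣ X′ ∣ + ∣ translate Y′ (negate e) ∣                     ≡⟨ cong (∣ X′ ∣ +_) (count-cong _ _ q translated-Y′) ⟩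
      ∣ X′ ∣ + count (λ z → X z ∧ translate Y (negate e) z) q  ≡⟨ count-∨-∧ X (translate Y (negate e)) q ⟩
      ∣ X ∣ + ∣ translate Y (negate e) ∣                       ≡⟨ cong (∣ X ∣ +_) (∣translate∣ Y (negate e)) ⟩
      ∣ X ∣ + ∣ Y ∣                                            ∎
      where
      open ≡-Reasoning
      translated-Y′ : ∀ z → z < q → translate Y′ (negate e) z ≡ (X z ∧ translate Y (negate e) z)
      translated-Y′ z z<q = trans (cong (λ t → translate Y (negate e) z ∧ X t) (-e+e z z<q)) (∧-comm _ (X z))
    sumset-shrinks : ∀ z → z < q → T ((X′ ⊕ Y′) z) → T ((X ⊕ Y) z)
    sumset-shrinks z _ X′⊕Y′z with ⊕-sound X′ Y′ z X′⊕Y′z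
    ... | x , y , x<q , y<q , X′x , Y′y , x+y≈z with to (T-∧ {Y y}) Y′y | to (T-∨ {X x}) X′x
    ...   | Yy , X[y+e] | inj₁ Xx = ⊕-complete X Y x<q y<q Xx Yy x+y≈z
    ...   | Yy , X[y+e] | inj₂ Y[x-e] = ⊕-complete X Y (m%n<n _ q) (m%n<n _ q) X[y+e] Y[x-e] (begin
      ((y + e) % q + (x + negate e) % q) % q  ≡⟨ ≈-+ (%-≈ (y + e)) (%-≈ (x + negate e)) ⟩
      (y + e + (x + negate e)) % q            ≡⟨ cong (_% q) (regroup y e x (negate e)) ⟩
      (x + negate e + e + y) % q              ≡⟨ ≈-+ʳ y (+-negate-+-≈ x e) ⟩
      (x + y) % q                             ≡⟨ x+y≈z ⟩
      z % q                                   ∎)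
      where
      open ≡-Reasoning
      regroup : ∀ y e x m → y + e + (x + m) ≡ x + m + e + y
      regroup = solve-∀

  CauchyDavenportBound : (ℕ → Bool) → (ℕ → Bool) → Set
  CauchyDavenportBound X Y = q ≤ ∣ X ⊕ Y ∣ ⊎ ∣ X ∣ + ∣ Y ∣ ≤ suc ∣ X ⊕ Y ∣

  private
    cauchy-davenport′ : ∀ n X Y → ∣ Y ∣ ≤ n → 1 ≤ ∣ X ∣ → 1 ≤ ∣ Y ∣ → CauchyDavenportBound X Y
    cauchy-davenport′ zero X Y ∣Y∣≤0 _ 1≤∣Y∣ = ⊥-elim (<⇒≱ 1≤∣Y∣ ∣Y∣≤0)
    cauchy-davenport′ (suc n) X Y ∣Y∣≤1+n 1≤∣X∣ 1≤∣Y∣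
      with count>0⇒witness Y q 1≤∣Y∣ | ∣ Y ∣ ≤? 1
    ... | y₁ , y₁<q , Yy₁ | yes ∣Y∣≤1 = inj₂ (begin
      ∣ X ∣ + ∣ Y ∣    ≤⟨ +-monoʳ-≤ ∣ X ∣ ∣Y∣≤1 ⟩
      ∣ X ∣ + 1        ≡⟨ +-comm ∣ X ∣ 1 ⟩
      suc ∣ X ∣        ≤⟨ s≤s (∣X∣≤∣X⊕Y∣ X Y y₁<q Yy₁) ⟩
      suc ∣ X ⊕ Y ∣    ∎)
      where open ≤-Reasoning
    ... | y₁ , y₁<q , Yy₁ | no ∣Y∣≰1
      with second-element Y Yy₁ (≰⇒> ∣Y∣≰1) | count>0⇒witness X q 1≤∣X∣ | T? (anyBelow (splits X Y) q)
    ... | y₂ , y₂<q , Yy₂ , y₂≢y₁ | x₀ , x₀<q , Xx₀ | no unsplit =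
      inj₁ (unsplit⇒q≤∣X⊕Y∣ X Y (λ e e<q split → unsplit (anyBelow-complete _ q e e<q split))
              x₀<q Xx₀ y₁<q Yy₁ y₂<q Yy₂ y₂≢y₁)
    ... | _ | _ | yes some-split with anyBelow-sound _ q some-split
    ...   | e , _ , split =
      transfer (cauchy-davenport′ n X′ Y′ ∣Y′∣≤n (≤-trans 1≤∣X∣ ∣X∣≤∣X′∣) 1≤∣Y′∣)
      where
      open Transform (e-transform X Y e split)
      ∣Y′∣≤n : ∣ Y′ ∣ ≤ n
      ∣Y′∣≤n = s≤s⁻¹ (≤-trans ∣Y′∣<∣Y∣ ∣Y∣≤1+n)
      ∣X′⊕Y′∣≤∣X⊕Y∣ : ∣ X′ ⊕ Y′ ∣ ≤ ∣ X ⊕ Y ∣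
      ∣X′⊕Y′∣≤∣X⊕Y∣ = count-mono _ _ q X′⊕Y′⊆X⊕Y
      transfer : CauchyDavenportBound X′ Y′ → CauchyDavenportBound X Y
      transfer (inj₁ q≤∣X′⊕Y′∣) = inj₁ (≤-trans q≤∣X′⊕Y′∣ ∣X′⊕Y′∣≤∣X⊕Y∣)
      transfer (inj₂ bound)     = inj₂ (begin
        ∣ X ∣ + ∣ Y ∣      ≡⟨ ∣X′∣+∣Y′∣ ⟨
        ∣ X′ ∣ + ∣ Y′ ∣    ≤⟨ bound ⟩
        suc ∣ X′ ⊕ Y′ ∣    ≤⟨ s≤s ∣X′⊕Y′∣≤∣X⊕Y∣ ⟩
        suc ∣ X ⊕ Y ∣      ∎)
        where open ≤-Reasoning

  cauchy-davenport : ∀ X Y → 1 ≤ ∣ X ∣ → 1 ≤ ∣ Y ∣ → CauchyDavenportBound X Y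
  cauchy-davenport X Y = cauchy-davenport′ ∣ Y ∣ X Y ≤-refl

  ⊕-bound : ∀ X Y s → 1 ≤ ∣ X ∣ → q ≤ ∣ Y ∣ ⊎ suc s ≤ ∣ Y ∣ →
            q ≤ ∣ X ⊕ Y ∣ ⊎ ∣ X ∣ + s ≤ ∣ X ⊕ Y ∣
  ⊕-bound X Y s 1≤∣X∣ Y-bound with cauchy-davenport X Y 1≤∣X∣ (nonempty Y-bound)
    where
    nonempty : q ≤ ∣ Y ∣ ⊎ suc s ≤ ∣ Y ∣ → 1 ≤ ∣ Y ∣
    nonempty (inj₁ q≤∣Y∣)   = ≤-trans (>-nonZero⁻¹ q) q≤∣Y∣
    nonempty (inj₂ 1+s≤∣Y∣) = ≤-trans (s≤s z≤n) 1+s≤∣Y∣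
  ... | inj₁ q≤∣X⊕Y∣ = inj₁ q≤∣X⊕Y∣
  ... | inj₂ cd with Y-bound
  ...   | inj₁ q≤∣Y∣ = inj₁ (≤-trans q≤∣Y∣ (s≤s⁻¹ (begin
    suc ∣ Y ∣         ≤⟨ +-monoˡ-≤ ∣ Y ∣ 1≤∣X∣ ⟩
    ∣ X ∣ + ∣ Y ∣     ≤⟨ cd ⟩
    suc ∣ X ⊕ Y ∣     ∎)))
    where open ≤-Reasoning
  ...   | inj₂ 1+s≤∣Y∣ = inj₂ (s≤s⁻¹ (begin
    suc (∣ X ∣ + s)   ≡⟨ +-suc ∣ X ∣ s ⟨
    ∣ X ∣ + suc s     ≤⟨ +-monoʳ-≤ ∣ X ∣ 1+s≤∣Y∣ ⟩
    ∣ X ∣ + ∣ Y ∣     ≤⟨ cd ⟩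
    suc ∣ X ⊕ Y ∣     ∎))
    where open ≤-Reasoning

  _∪0 : (ℕ → Bool) → ℕ → Bool
  (A ∪0) z = A z ∨ singleton 0 z

  ∣A∪0∣ : ∀ A → ¬ T (A 0) → ∣ A ∪0 ∣ ≡ suc ∣ A ∣
  ∣A∪0∣ A 0∉A = begin
    ∣ A ∪0 ∣                                        ≡⟨ +-identityʳ _ ⟨
    ∣ A ∪0 ∣ + 0                                    ≡⟨ cong (∣ A ∪0 ∣ +_) disjoint ⟨
    ∣ A ∪0 ∣ + count (λ z → A z ∧ singleton 0 z) q  ≡⟨ count-∨-∧ A (singleton 0) q ⟩
    ∣ A ∣ + ∣ singleton 0 ∣                         ≡⟨ cong (∣ A ∣ +_) (count-singleton 0 q (>-nonZero⁻¹ q)) ⟩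
    ∣ A ∣ + 1                                       ≡⟨ +-comm ∣ A ∣ 1 ⟩
    suc ∣ A ∣                                       ∎
    where
    open ≡-Reasoning
    disjoint : count (λ z → A z ∧ singleton 0 z) q ≡ 0
    disjoint = trans (count-cong _ _ q meet-false) (count-false q)
      where
      meet-false : ∀ z → z < q → (A z ∧ singleton 0 z) ≡ false
      meet-false zero    _ with A 0
      ... | true  = ⊥-elim (0∉A tt)
      ... | false = refl
      meet-false (suc z) _ = ∧-zeroʳ (A (suc z))

  subsums : List (ℕ → Bool) → ℕ → Bool
  subsums []       = singleton 0
  subsums (A ∷ As) = A ∪0 ⊕ subsums As

  sizeSum : List (ℕ → Bool) → ℕ
  sizeSum As = sum (map ∣_∣ As)

  ∣subsums∣ : ∀ As → All (λ A → ¬ T (A 0)) As → q ≤ ∣ subsums As ∣ ⊎ suc (sizeSum As) ≤ ∣ subsums As ∣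
  ∣subsums∣ []       []           = inj₂ (≤-reflexive (sym (count-singleton 0 q (>-nonZero⁻¹ q))))
  ∣subsums∣ (A ∷ As) (0∉A ∷ 0∉As) =
    subst (λ a → q ≤ ∣ subsums (A ∷ As) ∣ ⊎ a + sizeSum As ≤ ∣ subsums (A ∷ As) ∣) (∣A∪0∣ A 0∉A)
      (⊕-bound (A ∪0) (subsums As) (sizeSum As) 1≤∣A∪0∣ (∣subsums∣ As 0∉As))
    where
    1≤∣A∪0∣ : 1 ≤ ∣ A ∪0 ∣
    1≤∣A∪0∣ = ≤-trans (s≤s z≤n) (≤-reflexive (sym (∣A∪0∣ A 0∉A)))

  A⊕subsums-full : ∀ A As → 1 ≤ ∣ A ∣ → All (λ A → ¬ T (A 0)) As → q ≤ ∣ A ∣ + sizeSum As →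
                   ∀ z → z < q → T ((A ⊕ subsums As) z)
  A⊕subsums-full A As 1≤∣A∣ 0∉As q≤sizes =
    count-full _ q (bound (⊕-bound A (subsums As) (sizeSum As) 1≤∣A∣ (∣subsums∣ As 0∉As)))
    where
    bound : q ≤ ∣ A ⊕ subsums As ∣ ⊎ ∣ A ∣ + sizeSum As ≤ ∣ A ⊕ subsums As ∣ → q ≤ ∣ A ⊕ subsums As ∣
    bound (inj₁ q≤) = q≤
    bound (inj₂ ≤∣A⊕S∣) = ≤-trans q≤sizes ≤∣A⊕S∣

-- The group C_q ⋊ C_4

toℕ-mod : ∀ m n .{{_ : NonZero n}} → toℕ (m mod n) ≡ m % n
toℕ-mod m n = toℕ-fromℕ< (m%n<n m n)

mod-cong : ∀ m k n .{{_ : NonZero n}} → m % n ≡ k % n → m mod n ≡ k mod n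
mod-cong m k n eq = toℕ-injective (trans (toℕ-mod m n) (trans eq (sym (toℕ-mod k n))))

module Group (q r : ℕ) .{{_ : NonZero q}} (q∣r²+1 : q ∣ r * r + 1) where
  open Congruence q
  open Sequences (mul q r) (one q)

  τ-degree α-degree : Elem q → ℕ
  τ-degree (a , _) = toℕ a
  α-degree (_ , i) = toℕ i

  τ-exp : List (Elem q) → ℕ
  τ-exp L = sum (map τ-degree L)

  α-exp : List (Elem q) → ℕ
  α-exp []      = 0
  α-exp (x ∷ L) = α-degree x * r ^ τ-exp L + α-exp L

  r²+1≈0 : r * r + 1 ≈ 0
  r²+1≈0 = ∣⇒≈0 q∣r²+1

  r⁴≈1 : r ^ 4 ≈ 1
  r⁴≈1 = ≈-cancelʳ-+ (2 * (r * r + 1)) (begin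
    (r ^ 4 + 2 * (r * r + 1)) % q            ≡⟨ cong (_% q) (square r) ⟩
    ((r * r + 1) * (r * r + 1) + 1) % q      ≡⟨ ≈-+ʳ 1 (≈-* r²+1≈0 r²+1≈0) ⟩
    1 % q                                    ≡⟨ ≈-+ˡ 1 (≈-*ˡ 2 r²+1≈0) ⟨
    (1 + 2 * (r * r + 1)) % q                ∎)
    where
    open ≡-Reasoning
    square : ∀ x → x * (x * (x * (x * 1))) + 2 * (x * x + 1) ≡ (x * x + 1) * (x * x + 1) + 1
    square = solve-∀

  r^n≈r^[n%4] : ∀ n → r ^ n ≈ r ^ (n % 4)
  r^n≈r^[n%4] n = begin
    (r ^ n) % q                          ≡⟨ cong (λ m → r ^ m % q) n≡n%4+4[n/4] ⟩
    (r ^ (n % 4 + 4 * (n / 4))) % q      ≡⟨ cong (_% q) (^-distribˡ-+-* r (n % 4) _) ⟩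
    (r ^ (n % 4) * r ^ (4 * (n / 4))) % q ≡⟨ cong (λ m → (r ^ (n % 4) * m) % q) (^-*-assoc r 4 (n / 4)) ⟨
    (r ^ (n % 4) * (r ^ 4) ^ (n / 4)) % q ≡⟨ ≈-*ˡ (r ^ (n % 4)) (≈-^ (n / 4) r⁴≈1) ⟩
    (r ^ (n % 4) * 1 ^ (n / 4)) % q      ≡⟨ cong (λ m → (r ^ (n % 4) * m) % q) (^-zeroˡ (n / 4)) ⟩
    (r ^ (n % 4) * 1) % q                ≡⟨ cong (_% q) (*-identityʳ _) ⟩
    (r ^ (n % 4)) % q                    ∎
    where
    open ≡-Reasoning
    n≡n%4+4[n/4] : n ≡ n % 4 + 4 * (n / 4)
    n≡n%4+4[n/4] = trans (m≡m%n+[m/n]*n n 4) (cong (n % 4 +_) (*-comm (n / 4) 4))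

  prod-≡ : ∀ L → prod L ≡ (τ-exp L mod 4 , α-exp L mod q)
  prod-≡ []            = refl
  prod-≡ ((a , i) ∷ L) rewrite prod-≡ L = cong₂ _,_
    (mod-cong (toℕ a + toℕ (τ-exp L mod 4)) (toℕ a + τ-exp L) 4 τ-step)
    (mod-cong _ (toℕ i * r ^ τ-exp L + α-exp L) q α-step)
    where
    τ-step : (toℕ a + toℕ (τ-exp L mod 4)) % 4 ≡ (toℕ a + τ-exp L) % 4
    τ-step = trans (cong (λ t → (toℕ a + t) % 4) (toℕ-mod (τ-exp L) 4))
                   (Congruence.≈-+ˡ 4 (toℕ a) (Congruence.%-≈ 4 (τ-exp L)))
    α-step : (toℕ i * r ^ toℕ (τ-exp L mod 4) + toℕ (α-exp L mod q)) % q ≡ (toℕ i * r ^ τ-exp L + α-exp L) % q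
    α-step = ≈-+ (≈-*ˡ (toℕ i) (trans (cong (λ t → r ^ t % q) (toℕ-mod (τ-exp L) 4)) (sym (r^n≈r^[n%4] (τ-exp L)))))
                 (trans (cong (_% q) (toℕ-mod (α-exp L) q)) (%-≈ (α-exp L)))

  prod≡one⇒ : ∀ L → prod L ≡ one q → τ-exp L % 4 ≡ 0 × α-exp L ≈ 0
  prod≡one⇒ L prod≡one =
      trans (sym (toℕ-mod (τ-exp L) 4)) (trans (cong (toℕ ∘ proj₁) prod-L≡one) (toℕ-mod 0 4))
    , trans (sym (toℕ-mod (α-exp L) q)) (trans (cong (toℕ ∘ proj₂) prod-L≡one) (toℕ-mod 0 q))
    where
    prod-L≡one : (τ-exp L mod 4 , α-exp L mod q) ≡ one q
    prod-L≡one = trans (sym (prod-≡ L)) prod≡one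

  ⇒prod≡one : ∀ L → τ-exp L % 4 ≡ 0 → α-exp L ≈ 0 → prod L ≡ one q
  ⇒prod≡one L τ≡0 α≈0 = trans (prod-≡ L) (cong₂ _,_ (mod-cong (τ-exp L) 0 4 τ≡0) (mod-cong (α-exp L) 0 q α≈0))

  τ-exp-++ : ∀ A B → τ-exp (A ++ B) ≡ τ-exp A + τ-exp B
  τ-exp-++ A B = trans (cong sum (map-++ τ-degree A B)) (sum-++ (map τ-degree A) (map τ-degree B))

  α-exp-++ : ∀ A B → α-exp (A ++ B) ≡ α-exp A * r ^ τ-exp B + α-exp B
  α-exp-++ []      B = refl
  α-exp-++ (x ∷ A) B = begin
    α-degree x * r ^ τ-exp (A ++ B) + α-exp (A ++ B)
      ≡⟨ cong₂ (λ t u → α-degree x * r ^ t + u) (τ-exp-++ A B) (α-exp-++ A B) ⟩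
    α-degree x * r ^ (τ-exp A + τ-exp B) + (α-exp A * r ^ τ-exp B + α-exp B)
      ≡⟨ cong (λ t → α-degree x * t + (α-exp A * r ^ τ-exp B + α-exp B)) (^-distribˡ-+-* r (τ-exp A) (τ-exp B)) ⟩
    α-degree x * (r ^ τ-exp A * r ^ τ-exp B) + (α-exp A * r ^ τ-exp B + α-exp B)
      ≡⟨ factor (α-degree x) (r ^ τ-exp A) (r ^ τ-exp B) (α-exp A) (α-exp B) ⟩
    (α-degree x * r ^ τ-exp A + α-exp A) * r ^ τ-exp B + α-exp B ∎
    where
    open ≡-Reasoning
    factor : ∀ i a b v w → i * (a * b) + (v * b + w) ≡ (i * a + v) * b + w
    factor = solve-∀

  r^[0%4]≈1 : ∀ n → n % 4 ≡ 0 → r ^ n ≈ 1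
  r^[0%4]≈1 n n%4≡0 = trans (r^n≈r^[n%4] n) (cong (λ m → r ^ m % q) n%4≡0)

  α-exp-++-balanced : ∀ A B → τ-exp B % 4 ≡ 0 → α-exp (A ++ B) ≈ α-exp A + α-exp B
  α-exp-++-balanced A B τ≡0 = begin
    α-exp (A ++ B) % q                         ≡⟨ cong (_% q) (α-exp-++ A B) ⟩
    (α-exp A * r ^ τ-exp B + α-exp B) % q      ≡⟨ ≈-+ʳ (α-exp B) (≈-*ˡ (α-exp A) (r^[0%4]≈1 (τ-exp B) τ≡0)) ⟩
    (α-exp A * 1 + α-exp B) % q                ≡⟨ cong (λ t → (t + α-exp B) % q) (*-identityʳ (α-exp A)) ⟩
    (α-exp A + α-exp B) % q                    ∎
    where open ≡-Reasoning

  α-exp-rotate : ∀ P Q → τ-exp (P ++ Q) % 4 ≡ 0 → α-exp (Q ++ P) ≈ r ^ τ-exp P * α-exp (P ++ Q)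
  α-exp-rotate P Q τ≡0 = begin
    α-exp (Q ++ P) % q
      ≡⟨ cong (_% q) (α-exp-++ Q P) ⟩
    (α-exp Q * r ^ τ-exp P + α-exp P) % q
      ≡⟨ cong (λ t → (α-exp Q * r ^ τ-exp P + t) % q) (*-identityʳ (α-exp P)) ⟨
    (α-exp Q * r ^ τ-exp P + α-exp P * 1) % q
      ≡⟨ ≈-+ˡ (α-exp Q * r ^ τ-exp P) (≈-*ˡ (α-exp P) (r^[0%4]≈1 (τ-exp (P ++ Q)) τ≡0)) ⟨
    (α-exp Q * r ^ τ-exp P + α-exp P * r ^ (τ-exp (P ++ Q))) % q
      ≡⟨ cong (λ t → (α-exp Q * r ^ τ-exp P + α-exp P * r ^ t) % q) (τ-exp-++ P Q) ⟩
    (α-exp Q * r ^ τ-exp P + α-exp P * r ^ (τ-exp P + τ-exp Q)) % q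
      ≡⟨ cong (λ t → (α-exp Q * r ^ τ-exp P + α-exp P * t) % q) (^-distribˡ-+-* r (τ-exp P) (τ-exp Q)) ⟩
    (α-exp Q * r ^ τ-exp P + α-exp P * (r ^ τ-exp P * r ^ τ-exp Q)) % q
      ≡⟨ cong (_% q) (factor (α-exp Q) (r ^ τ-exp P) (α-exp P) (r ^ τ-exp Q)) ⟩
    (r ^ τ-exp P * (α-exp P * r ^ τ-exp Q + α-exp Q)) % q
      ≡⟨ cong (λ t → (r ^ τ-exp P * t) % q) (α-exp-++ P Q) ⟨
    (r ^ τ-exp P * α-exp (P ++ Q)) % q ∎
    where
    open ≡-Reasoning
    factor : ∀ w a v b → w * a + v * (a * b) ≡ a * (v * b + w)
    factor = solve-∀

  module OrderFour (q-prime : Prime q) (q-odd : ¬ 2 ∣ q) where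
    open PrimeCongruence q q-prime

    1<q : 1 < q
    1<q = nonTrivial⇒n>1 q {{prime⇒nonTrivial q-prime}}

    1≉0 : ¬ 1 ≈ 0
    1≉0 1≈0 = <⇒≢ 1<q (sym (∣1⇒≡1 (≈0⇒∣ 1≈0)))

    2≉0 : ¬ 2 ≈ 0
    2≉0 2≈0 = q-odd (subst (2 ∣_) (sym q≡2) ∣-refl)
      where
      q≡2 : q ≡ 2
      q≡2 = ≤-antisym (∣⇒≤ (≈0⇒∣ 2≈0)) 1<q

    r≉0 : ¬ r ≈ 0
    r≉0 r≈0 = 1≉0 (trans (sym (≈-+ʳ 1 (≈-* r≈0 r≈0))) r²+1≈0)

    r²≉1 : ¬ r * r ≈ 1
    r²≉1 r²≈1 = 2≉0 (trans (sym (≈-+ʳ 1 r²≈1)) r²+1≈0)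

    r^n≉0 : ∀ n → ¬ r ^ n ≈ 0
    r^n≉0 zero    = 1≉0
    r^n≉0 (suc n) r^[1+n]≈0 with ≈0-* r (r ^ n) r^[1+n]≈0
    ... | inj₁ r≈0   = r≉0 r≈0
    ... | inj₂ r^n≈0 = r^n≉0 n r^n≈0

    r^c≉1 : ∀ c → 1 ≤ c → c ≤ 3 → ¬ r ^ c ≈ 1
    r^c≉1 1 _ _ r¹≈1 = r²≉1 (≈-* r≈1 r≈1)
      where
      r≈1 : r ≈ 1
      r≈1 = trans (≡⇒≈ (sym (*-identityʳ r))) r¹≈1
    r^c≉1 2 _ _ r²≈1 = r²≉1 (trans (≡⇒≈ (cong (r *_) (sym (*-identityʳ r)))) r²≈1)
    r^c≉1 3 _ _ r³≈1 = r²≉1 (≈-* r≈1 r≈1)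
      where
      r≈1 : r ≈ 1
      r≈1 = trans (≡⇒≈ (sym (*-identityʳ r))) (trans (sym (≈-*ˡ r r³≈1)) r⁴≈1)
    r^c≉1 (suc (suc (suc (suc _)))) _ (s≤s (s≤s (s≤s ())))

    private
      r^a≉r^b : ∀ {a b} → a < b → b < 4 → ¬ r ^ a ≈ r ^ b
      r^a≉r^b {a} {b} a<b b<4 r^a≈r^b = r^c≉1 (b ∸ a) (m<n⇒0<n∸m a<b) b∸a≤3 (sym (≈-cancelˡ-* (r^n≉0 a) (begin
        (r ^ a * 1) % q              ≡⟨ cong (_% q) (*-identityʳ (r ^ a)) ⟩
        (r ^ a) % q                  ≡⟨ r^a≈r^b ⟩
        (r ^ b) % q                  ≡⟨ cong (λ t → r ^ t % q) (m+[n∸m]≡n (<⇒≤ a<b)) ⟨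
        (r ^ (a + (b ∸ a))) % q      ≡⟨ cong (_% q) (^-distribˡ-+-* r a (b ∸ a)) ⟩
        (r ^ a * r ^ (b ∸ a)) % q    ∎)))
        where
        open ≡-Reasoning
        b∸a≤3 : b ∸ a ≤ 3
        b∸a≤3 = ≤-trans (m∸n≤m b a) (s≤s⁻¹ b<4)

      r^[a%4]≈r^[b%4] : ∀ a b {v} → ¬ v ≈ 0 → r ^ a * v ≈ r ^ b * v → r ^ (a % 4) ≈ r ^ (b % 4)
      r^[a%4]≈r^[b%4] a b {v} v≉0 r^av≈r^bv = begin
        (r ^ (a % 4)) % q  ≡⟨ r^n≈r^[n%4] a ⟨
        (r ^ a) % q        ≡⟨ ≈-cancelˡ-* v≉0 v*r^a≈v*r^b ⟩
        (r ^ b) % q        ≡⟨ r^n≈r^[n%4] b ⟩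
        (r ^ (b % 4)) % q  ∎
        where
        open ≡-Reasoning
        v*r^a≈v*r^b : v * r ^ a ≈ v * r ^ b
        v*r^a≈v*r^b = trans (≡⇒≈ (*-comm v (r ^ a))) (trans r^av≈r^bv (≡⇒≈ (*-comm (r ^ b) v)))

    r^-injective : ∀ a b {v} → ¬ v ≈ 0 → r ^ a * v ≈ r ^ b * v → a % 4 ≡ b % 4
    r^-injective a b v≉0 r^av≈r^bv with <-cmp (a % 4) (b % 4)
    ... | tri< a′<b′ _ _ = ⊥-elim (r^a≉r^b a′<b′ (m%n<n b 4) (r^[a%4]≈r^[b%4] a b v≉0 r^av≈r^bv))
    ... | tri≈ _ a′≡b′ _ = a′≡b′
    ... | tri> _ _ a′>b′ = ⊥-elim (r^a≉r^b a′>b′ (m%n<n a 4) (sym (r^[a%4]≈r^[b%4] a b v≉0 r^av≈r^bv)))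

-- Subsequences and blocks

module SubSeqProperties {A : Set} (_·_ : A → A → A) (e : A) where
  open Sequences _·_ e

  ↭⇒SubSeq : ∀ {T S} → T ↭ S → SubSeq T S
  ↭⇒SubSeq {T} T↭S = [] , ↭-trans (↭-reflexive (++-identityʳ T)) T↭S

  []-SubSeq : ∀ S → SubSeq [] S
  []-SubSeq S = S , ↭-refl

  SubSeq-trans : ∀ {T S R} → SubSeq T S → SubSeq S R → SubSeq T R
  SubSeq-trans {T} (U , T++U↭S) (V , S++V↭R) =
    U ++ V , ↭-trans (↭-reflexive (sym (++-assoc T U V))) (↭-trans (++⁺ʳ V T++U↭S) S++V↭R)

  ++-SubSeq : ∀ {T S T′ S′} → SubSeq T S → SubSeq T′ S′ → SubSeq (T ++ T′) (S ++ S′)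
  ++-SubSeq {T} {S} {T′} {S′} (U , T++U↭S) (U′ , T′++U′↭S′) = U ++ U′ , (begin
    (T ++ T′) ++ U ++ U′  ≡⟨ ++-assoc T T′ (U ++ U′) ⟩
    T ++ T′ ++ U ++ U′    ↭⟨ ++⁺ˡ T (shifts T′ U) ⟩
    T ++ U ++ T′ ++ U′    ≡⟨ ++-assoc T U (T′ ++ U′) ⟨
    (T ++ U) ++ T′ ++ U′  ↭⟨ ++⁺ T++U↭S T′++U′↭S′ ⟩
    S ++ S′               ∎)
    where open PermutationReasoning

  SubSeq-++ˡ : ∀ {T} S {S′} → SubSeq T S′ → SubSeq T (S ++ S′)
  SubSeq-++ˡ S = ++-SubSeq ([]-SubSeq S)

  SubSeq-All : ∀ {P : A → Set} {T S} → All P S → SubSeq T S → All P T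
  SubSeq-All {T = T} PS (U , T++U↭S) = All.++⁻ˡ T (All-resp-↭ (↭-sym T++U↭S) PS)

  SubSeq-sum : ∀ (f : A → ℕ) {T S} → SubSeq T S → sum (map f T) ≤ sum (map f S)
  SubSeq-sum f {T} {S} (U , T++U↭S) = begin
    sum (map f T)                      ≤⟨ m≤m+n _ _ ⟩
    sum (map f T) + sum (map f U)      ≡⟨ sum-++ (map f T) (map f U) ⟨
    sum (map f T ++ map f U)           ≡⟨ cong sum (map-++ f T U) ⟨
    sum (map f (T ++ U))               ≡⟨ sum-↭ (map⁺ f T++U↭S) ⟩
    sum (map f S)                      ∎
    where open ≤-Reasoning

module Blocks (q r : ℕ) .{{_ : NonZero q}} (q-prime : Prime q) (q-odd : ¬ 2 ∣ q) (q∣r²+1 : q ∣ r * r + 1) where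
  open Congruence q
  open PrimeCongruence q q-prime
  open Group q r q∣r²+1
  open OrderFour q-prime q-odd
  open Sumset q q-prime
  open Sequences (mul q r) (one q)
  open SubSeqProperties (mul q r) (one q)

  rotate : ℕ → List (Elem q) → List (Elem q)
  rotate k B = drop k B ++ take k B

  rotate-↭ : ∀ k B → rotate k B ↭ B
  rotate-↭ k B = ↭-trans (++-comm (drop k B) (take k B)) (↭-reflexive (take++drop≡id k B))

  τ-exp-rotate : ∀ k B → τ-exp (rotate k B) ≡ τ-exp B
  τ-exp-rotate k B = begin
    τ-exp (drop k B ++ take k B)      ≡⟨ τ-exp-++ (drop k B) (take k B) ⟩
    τ-exp (drop k B) + τ-exp (take k B) ≡⟨ +-comm (τ-exp (drop k B)) _ ⟩
    τ-exp (take k B) + τ-exp (drop k B) ≡⟨ τ-exp-++ (take k B) (drop k B) ⟨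
    τ-exp (take k B ++ drop k B)      ≡⟨ cong τ-exp (take++drop≡id k B) ⟩
    τ-exp B                           ∎
    where open ≡-Reasoning

  α-exp-rotate-by : ∀ k B → τ-exp B % 4 ≡ 0 → α-exp (rotate k B) ≈ r ^ τ-exp (take k B) * α-exp B
  α-exp-rotate-by k B τ≡0 =
    trans (α-exp-rotate (take k B) (drop k B) (subst (λ C → τ-exp C % 4 ≡ 0) (sym (take++drop≡id k B)) τ≡0))
          (cong (λ C → (r ^ τ-exp (take k B) * α-exp C) % q) (take++drop≡id k B))

  record Block : Set where
    field
      elems             : List (Elem q)
      nonempty          : 1 ≤ length elems
      τ-exp≡0           : τ-exp elems % 4 ≡ 0
      prefixes-distinct : Unique (map (λ k → τ-exp (take k elems) % 4) (upTo (length elems)))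

  open Block

  rotationValue : Block → ℕ → ℕ
  rotationValue b k = α-exp (rotate k (elems b)) % q

  rotationValues : Block → List ℕ
  rotationValues b = map (rotationValue b) (upTo (length (elems b)))

  values : Block → ℕ → Bool
  values b = elementOf (rotationValues b)

  module _ (b : Block) (α≉0 : ¬ α-exp (elems b) ≈ 0) where

    rotationValues-unique : Unique (rotationValues b)
    rotationValues-unique = AllPairs.map⁺ {f = rotationValue b}
      (AllPairs.map (λ {k} {l} → value-distinct k l) (AllPairs.map⁻ {f = prefix-τ} (prefixes-distinct b)))
      where
      prefix-τ : ℕ → ℕ
      prefix-τ k = τ-exp (take k (elems b)) % 4
      value-distinct : ∀ k l → prefix-τ k ≢ prefix-τ l → rotationValue b k ≢ rotationValue b l
      value-distinct k l prefixes≢ values≡ =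
        prefixes≢ (r^-injective (τ-exp (take k (elems b))) (τ-exp (take l (elems b))) α≉0 (begin
        (r ^ τ-exp (take k (elems b)) * α-exp (elems b)) % q  ≡⟨ α-exp-rotate-by k (elems b) (τ-exp≡0 b) ⟨
        rotationValue b k                                     ≡⟨ values≡ ⟩
        rotationValue b l                                     ≡⟨ α-exp-rotate-by l (elems b) (τ-exp≡0 b) ⟩
        (r ^ τ-exp (take l (elems b)) * α-exp (elems b)) % q  ∎))
        where open ≡-Reasoning

    ∣values∣ : ∣ values b ∣ ≡ length (elems b)
    ∣values∣ = begin
      ∣ values b ∣                 ≡⟨ count-elementOf (rotationValues b) q (all-< (upTo ℓ)) rotationValues-unique ⟩
      length (rotationValues b)    ≡⟨ length-map (rotationValue b) (upTo ℓ) ⟩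
      length (upTo ℓ)              ≡⟨ length-upTo ℓ ⟩
      ℓ                            ∎
      where
      open ≡-Reasoning
      ℓ : ℕ
      ℓ = length (elems b)
      all-< : ∀ ks → All (_< q) (map (rotationValue b) ks)
      all-< []       = []
      all-< (k ∷ ks) = m%n<n _ q ∷ all-< ks

    0∉values : ¬ T (values b 0)
    0∉values 0∈ with ∈-map⁻ _ (elementOf-sound (rotationValues b) 0∈)
    ... | k , _ , 0≡v with ≈0-* (r ^ τ-exp (take k (elems b))) (α-exp (elems b)) (begin
      (r ^ τ-exp (take k (elems b)) * α-exp (elems b)) % q  ≡⟨ α-exp-rotate-by k (elems b) (τ-exp≡0 b) ⟨
      rotationValue b k                                     ≡⟨ 0≡v ⟨
      0                                                     ≡⟨ 0%n≡0 q ⟨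
      0 % q                                                 ∎)
      where open ≡-Reasoning
    ... | inj₁ r^≈0 = r^n≉0 (τ-exp (take k (elems b))) r^≈0
    ... | inj₂ α≈0  = α≉0 α≈0

  -- R, multiplied in its given order, equals α^z
  record Balanced (R : List (Elem q)) (z : ℕ) : Set where
    constructor balanced
    field
      τ-exp≡0 : τ-exp R % 4 ≡ 0
      α-exp≈z : α-exp R ≈ z

  Balanced-≈ : ∀ {R x z} → x ≈ z → Balanced R x → Balanced R z
  Balanced-≈ x≈z (balanced τ≡0 α≈x) = balanced τ≡0 (trans α≈x x≈z)

  ++-Balanced : ∀ {R₁ R₂ x y} → Balanced R₁ x → Balanced R₂ y → Balanced (R₁ ++ R₂) (x + y)
  ++-Balanced {R₁} {R₂} (balanced τ₁≡0 α₁≈x) (balanced τ₂≡0 α₂≈y) = balanced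
    (trans (cong (_% 4) (τ-exp-++ R₁ R₂)) (Congruence.≈-+ 4 {τ-exp R₁} {0} {τ-exp R₂} {0} τ₁≡0 τ₂≡0))
    (trans (α-exp-++-balanced R₁ R₂ τ₂≡0) (≈-+ α₁≈x α₂≈y))

  Balanced⇒ProductOne : ∀ {R} → Balanced R 0 → ProductOne R
  Balanced⇒ProductOne {R} (balanced τ≡0 α≈0) = R , ↭-refl , ⇒prod≡one R τ≡0 α≈0

  values-balanced : ∀ b {z} → T (values b z) → ∃[ R ] (R ↭ elems b × Balanced R z)
  values-balanced b {z} z∈ with ∈-map⁻ (rotationValue b) (elementOf-sound (rotationValues b) z∈)
  ... | k , _ , z≡v = rotate k (elems b) , rotate-↭ k (elems b) , balanced
                      (trans (cong (_% 4) (τ-exp-rotate k (elems b))) (τ-exp≡0 b))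
                      (trans (sym (%-≈ _)) (cong (_% q) (sym z≡v)))

  Realisable : List Block → ℕ → Set
  Realisable bs z = ∃[ R ] (SubSeq R (concatMap elems bs) × Balanced R z)

  subsums-realisable : ∀ bs z → T (subsums (map values bs) z) → Realisable bs z
  subsums-realisable []       z z∈ = [] , []-SubSeq [] , balanced refl (cong (_% q) (sym (toWitness z∈)))
  subsums-realisable (b ∷ bs) z z∈ with ⊕-sound (values b ∪0) (subsums (map values bs)) z z∈
  ... | x , y , _ , _ , x∈ , y∈ , x+y≈z with subsums-realisable bs y y∈ | to (T-∨ {values b x}) x∈
  ...   | R , R⊆bs , R-bal | inj₂ x≡0 =
          R , SubSeq-++ˡ (elems b) R⊆bs , Balanced-≈ (trans (cong (λ t → (t + y) % q) (sym (toWitness x≡0))) x+y≈z) R-bal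
  ...   | R , R⊆bs , R-bal | inj₁ x∈b with values-balanced b x∈b
  ...     | Rb , Rb↭b , Rb-bal =
          Rb ++ R , ++-SubSeq (↭⇒SubSeq Rb↭b) R⊆bs , Balanced-≈ x+y≈z (++-Balanced Rb-bal R-bal)

  sumset-realisable : ∀ b bs z → T ((values b ⊕ subsums (map values bs)) z) →
                      ∃[ R ] (SubSeq R (concatMap elems (b ∷ bs)) × 1 ≤ length R × Balanced R z)
  sumset-realisable b bs z z∈ with ⊕-sound (values b) (subsums (map values bs)) z z∈
  ... | x , y , _ , _ , x∈b , y∈ , x+y≈z with subsums-realisable bs y y∈ | values-balanced b x∈b
  ...   | R , R⊆bs , R-bal | Rb , Rb↭b , Rb-bal =
          Rb ++ R , ++-SubSeq (↭⇒SubSeq Rb↭b) R⊆bs , nonempty′ , Balanced-≈ x+y≈z (++-Balanced Rb-bal R-bal)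
    where
    nonempty′ : 1 ≤ length (Rb ++ R)
    nonempty′ = begin
      1                        ≤⟨ nonempty b ⟩
      length (elems b)         ≡⟨ ↭-length Rb↭b ⟨
      length Rb                ≤⟨ m≤m+n (length Rb) (length R) ⟩
      length Rb + length R     ≡⟨ length-++ Rb ⟨
      length (Rb ++ R)         ∎
      where open ≤-Reasoning

  ∈⇒SubSeq-concat : ∀ {b bs} → b ∈ bs → SubSeq (elems b) (concatMap elems bs)
  ∈⇒SubSeq-concat {bs = b ∷ bs} (here refl) = concatMap elems bs , ↭-refl
  ∈⇒SubSeq-concat {bs = c ∷ bs} (there b∈) = SubSeq-++ˡ (elems c) (∈⇒SubSeq-concat b∈)

  sizeSum-values : ∀ bs → All (λ b → ¬ α-exp (elems b) ≈ 0) bs →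
                   sizeSum (map values bs) ≡ length (concatMap elems bs)
  sizeSum-values []       []             = refl
  sizeSum-values (b ∷ bs) (α≉0 ∷ α≉0s) =
    trans (cong₂ _+_ (∣values∣ b α≉0) (sizeSum-values bs α≉0s)) (sym (length-++ (elems b)))

  NonemptyProductOneIn : List (Elem q) → Set
  NonemptyProductOneIn S = ∃[ R ] (SubSeq R S × 1 ≤ length R × ProductOne R)

  zero-sum-free-blocks⇒product-one : ∀ bs → All (λ b → ¬ α-exp (elems b) ≈ 0) bs →
    q ≤ length (concatMap elems bs) → NonemptyProductOneIn (concatMap elems bs)
  zero-sum-free-blocks⇒product-one []       []             q≤0   = ⊥-elim (<⇒≱ (>-nonZero⁻¹ q) q≤0)
  zero-sum-free-blocks⇒product-one (b ∷ bs) (α≉0 ∷ α≉0s) q≤len =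
    let R , R⊆ , 1≤len , R-bal = sumset-realisable b bs 0 0∈sumset in R , R⊆ , 1≤len , Balanced⇒ProductOne R-bal
    where
    1≤∣values∣ : 1 ≤ ∣ values b ∣
    1≤∣values∣ = subst (1 ≤_) (sym (∣values∣ b α≉0)) (nonempty b)
    0∉subsums : All (λ A → ¬ T (A 0)) (map values bs)
    0∉subsums = All.map⁺ (All.map (λ {c} → 0∉values c) α≉0s)
    q≤sizes : q ≤ ∣ values b ∣ + sizeSum (map values bs)
    q≤sizes = subst (q ≤_) (sym (sizeSum-values (b ∷ bs) (α≉0 ∷ α≉0s))) q≤len
    0∈sumset : T ((values b ⊕ subsums (map values bs)) 0)
    0∈sumset = A⊕subsums-full (values b) (map values bs) 1≤∣values∣ 0∉subsums q≤sizes 0 (>-nonZero⁻¹ q)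

  blocks⇒product-one : ∀ bs → q ≤ length (concatMap elems bs) → NonemptyProductOneIn (concatMap elems bs)
  blocks⇒product-one bs q≤len with any? (λ b → α-exp (elems b) % q ≟ 0 % q) bs
  ... | no  none = zero-sum-free-blocks⇒product-one bs (¬Any⇒All¬ bs none) q≤len
  ... | yes some =
    let b , b∈bs , α≈0 = find some
    in elems b , ∈⇒SubSeq-concat b∈bs , nonempty b , Balanced⇒ProductOne (balanced (τ-exp≡0 b) α≈0)

module Decomposition (q r : ℕ) .{{_ : NonZero q}} (q-prime : Prime q) (q-odd : ¬ 2 ∣ q) (q∣r²+1 : q ∣ r * r + 1) where
  open Group q r q∣r²+1
  open Blocks q r q-prime q-odd q∣r²+1
  open Block

  -- for concrete τ-degrees the side conditions are discharged by evaluation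
  block : (B : List (Elem q)) {_ : True (1 ≤? length B)} {_ : True (τ-exp B % 4 ≟ 0)}
          {_ : True (unique? (map (λ k → τ-exp (take k B) % 4) (upTo (length B))))} → Block
  block B {ne} {bal} {uniq} = record
    { elems = B ; nonempty = toWitness ne ; τ-exp≡0 = toWitness bal ; prefixes-distinct = toWitness uniq }

  infix 4 _⇝_
  _⇝_ : List (Elem q) → List (Elem q) → Set
  S ⇝ R = ∃[ bs ] (concatMap elems bs ++ R ↭ S)

  ⇝-refl : ∀ {S} → S ⇝ S
  ⇝-refl = [] , ↭-refl

  ↭-⇝ : ∀ {S S′ R} → S ↭ S′ → S ⇝ R → S′ ⇝ R
  ↭-⇝ S↭S′ (bs , bs++R↭S) = bs , ↭-trans bs++R↭S S↭S′

  ⇝-block : ∀ b {B S R} → elems b ≡ B → S ⇝ R → B ++ S ⇝ R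
  ⇝-block b {B} refl (bs , bs++R↭S) = b ∷ bs , ↭-trans (↭-reflexive (++-assoc B _ _)) (++⁺ˡ B bs++R↭S)

  concatMap-++ : ∀ bs cs → concatMap elems (bs ++ cs) ≡ concatMap elems bs ++ concatMap elems cs
  concatMap-++ bs cs = trans (cong concat (map-++ elems bs cs)) (sym (concat-++ (map elems bs) (map elems cs)))

  ⇝-trans : ∀ {S R R′} → S ⇝ R → R ⇝ R′ → S ⇝ R′
  ⇝-trans {R′ = R′} (bs , bs++R↭S) (cs , cs++R′↭R) = bs ++ cs , (begin
    concatMap elems (bs ++ cs) ++ R′                 ≡⟨ cong (_++ R′) (concatMap-++ bs cs) ⟩
    (concatMap elems bs ++ concatMap elems cs) ++ R′ ≡⟨ ++-assoc (concatMap elems bs) _ R′ ⟩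
    concatMap elems bs ++ concatMap elems cs ++ R′   ↭⟨ ++⁺ˡ (concatMap elems bs) cs++R′↭R ⟩
    concatMap elems bs ++ _                          ↭⟨ bs++R↭S ⟩
    _                                                ∎)
    where open PermutationReasoning

  ⇝-++ : ∀ {S S′ R R′} → S ⇝ R → S′ ⇝ R′ → S ++ S′ ⇝ R ++ R′
  ⇝-++ {S} {S′} {R} {R′} (bs , bs++R↭S) (cs , cs++R′↭S′) = bs ++ cs , (begin
    concatMap elems (bs ++ cs) ++ R ++ R′                   ≡⟨ cong (_++ R ++ R′) (concatMap-++ bs cs) ⟩
    (concatMap elems bs ++ concatMap elems cs) ++ R ++ R′   ≡⟨ ++-assoc (concatMap elems bs) _ _ ⟩
    concatMap elems bs ++ concatMap elems cs ++ R ++ R′     ↭⟨ ++⁺ˡ (concatMap elems bs) (shifts (concatMap elems cs) R) ⟩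
    concatMap elems bs ++ R ++ concatMap elems cs ++ R′     ≡⟨ ++-assoc (concatMap elems bs) R _ ⟨
    (concatMap elems bs ++ R) ++ concatMap elems cs ++ R′   ↭⟨ ++⁺ bs++R↭S cs++R′↭S′ ⟩
    S ++ S′                                                 ∎)
    where open PermutationReasoning

  ofType : Fin 4 → List (Fin q) → List (Elem q)
  ofType t = map (t ,_)

  ofType0⇝[] : ∀ I → ofType 0F I ⇝ []
  ofType0⇝[] []      = ⇝-refl
  ofType0⇝[] (i ∷ I) = ⇝-block (block (ofType 0F (i ∷ []))) refl (ofType0⇝[] I)

  pair-1-3 : ∀ I J → ∃[ I′ ] ∃[ J′ ] ((I′ ≡ [] ⊎ J′ ≡ []) ×
             ofType 1F I ++ ofType 3F J ⇝ ofType 1F I′ ++ ofType 3F J′)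
  pair-1-3 []      J       = [] , J , inj₁ refl , ⇝-refl
  pair-1-3 (i ∷ I) []      = i ∷ I , [] , inj₂ refl , ⇝-refl
  pair-1-3 (i ∷ I) (j ∷ J) with pair-1-3 I J
  ... | I′ , J′ , one-empty , I,J⇝ = I′ , J′ , one-empty ,
        ↭-⇝ (prep (1F , i) (↭-sym (shift (3F , j) (ofType 1F I) (ofType 3F J))))
            (⇝-block (block (ofType 1F (i ∷ []) ++ ofType 3F (j ∷ []))) refl I,J⇝)

  pair-2-2 : ∀ I → ∃[ I′ ] (length I′ ≤ 1 × ofType 2F I ⇝ ofType 2F I′)
  pair-2-2 []          = [] , z≤n , ⇝-refl
  pair-2-2 (i ∷ [])    = i ∷ [] , ≤-refl , ⇝-refl
  pair-2-2 (i ∷ j ∷ I) with pair-2-2 I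
  ... | I′ , I′≤1 , I⇝ = I′ , I′≤1 , ⇝-block (block (ofType 2F (i ∷ j ∷ []))) refl I⇝

  module Leftover (t : Fin 4)
    (quad : (i j k l : Fin q) → Block)
    (quad-elems : ∀ i j k l → elems (quad i j k l) ≡ ofType t (i ∷ j ∷ k ∷ l ∷ []))
    (triple : (i j k : Fin q) → Block)
    (triple-elems : ∀ i j k → elems (triple i j k) ≡ ofType t (i ∷ j ∷ []) ++ ofType 2F (k ∷ []))
    where

    quads : ∀ I → ∃[ R ] (length R ≤ 3 × ofType t I ⇝ R)
    quads (i ∷ j ∷ k ∷ l ∷ I) with quads I
    ... | R , R≤3 , I⇝R = R , R≤3 , ⇝-block (quad i j k l) (quad-elems i j k l) I⇝R
    quads []                  = [] , z≤n , ⇝-refl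
    quads (i ∷ [])            = _ , s≤s z≤n , ⇝-refl
    quads (i ∷ j ∷ [])        = _ , s≤s (s≤s z≤n) , ⇝-refl
    quads (i ∷ j ∷ k ∷ [])    = _ , s≤s (s≤s (s≤s z≤n)) , ⇝-refl

    leftover : ∀ I M → length M ≤ 1 → ∃[ R ] (length R ≤ 3 × ofType t I ++ ofType 2F M ⇝ R)
    leftover I [] _ with quads I
    ... | R , R≤3 , I⇝R = R , R≤3 , ↭-⇝ (↭-reflexive (sym (++-identityʳ (ofType t I)))) I⇝R
    leftover (i ∷ j ∷ I) (k ∷ []) _ with quads I
    ... | R , R≤3 , I⇝R = R , R≤3 ,
          ↭-⇝ (prep (t , i) (prep (t , j) (∷↭∷ʳ (2F , k) (ofType t I))))
              (⇝-block (triple i j k) (triple-elems i j k) I⇝R)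
    leftover []          (k ∷ []) _ = _ , s≤s z≤n , ⇝-refl
    leftover (i ∷ [])    (k ∷ []) _ = _ , s≤s (s≤s z≤n) , ⇝-refl
    leftover I (k ∷ l ∷ M) (s≤s ())

  open Leftover 1F (λ i j k l → block (ofType 1F (i ∷ j ∷ k ∷ l ∷ []))) (λ _ _ _ _ → refl)
                   (λ i j k → block (ofType 1F (i ∷ j ∷ []) ++ ofType 2F (k ∷ []))) (λ _ _ _ → refl)
    using () renaming (leftover to leftover-1)
  open Leftover 3F (λ i j k l → block (ofType 3F (i ∷ j ∷ k ∷ l ∷ []))) (λ _ _ _ _ → refl)
                   (λ i j k → block (ofType 3F (i ∷ j ∷ []) ++ ofType 2F (k ∷ []))) (λ _ _ _ → refl)
    using () renaming (leftover to leftover-3)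

  record TypeSplit (S : List (Elem q)) : Set where
    constructor typeSplit
    field
      I₀ I₁ I₂ I₃ : List (Fin q)
      split       : ofType 0F I₀ ++ ofType 1F I₁ ++ ofType 2F I₂ ++ ofType 3F I₃ ↭ S

  splitByType : ∀ S → TypeSplit S
  splitByType [] = typeSplit [] [] [] [] ↭-refl
  splitByType (x@(0F , i) ∷ S) with typeSplit I₀ I₁ I₂ I₃ split ← splitByType S =
    typeSplit (i ∷ I₀) I₁ I₂ I₃ (prep x split)
  splitByType (x@(1F , i) ∷ S) with typeSplit I₀ I₁ I₂ I₃ split ← splitByType S =
    typeSplit I₀ (i ∷ I₁) I₂ I₃ (↭-trans (shift x (ofType 0F I₀) _) (prep x split))
  splitByType (x@(2F , i) ∷ S) with typeSplit I₀ I₁ I₂ I₃ split ← splitByType S =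
    typeSplit I₀ I₁ (i ∷ I₂) I₃
      (↭-trans (++⁺ˡ (ofType 0F I₀) (shift x (ofType 1F I₁) _))
      (↭-trans (shift x (ofType 0F I₀) _) (prep x split)))
  splitByType (x@(3F , i) ∷ S) with typeSplit I₀ I₁ I₂ I₃ split ← splitByType S =
    typeSplit I₀ I₁ I₂ (i ∷ I₃)
      (↭-trans (++⁺ˡ (ofType 0F I₀) (++⁺ˡ (ofType 1F I₁) (shift x (ofType 2F I₂) _)))
      (↭-trans (++⁺ˡ (ofType 0F I₀) (shift x (ofType 1F I₁) _))
      (↭-trans (shift x (ofType 0F I₀) _) (prep x split))))

  decompose : ∀ S → ∃[ R ] (length R ≤ 3 × S ⇝ R)
  decompose S with splitByType S
  ... | typeSplit I₀ I₁ I₂ I₃ split with pair-1-3 I₁ I₃ | pair-2-2 I₂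
  ...   | I₁′ , I₃′ , one-empty , I₁₃⇝ | I₂′ , I₂′≤1 , I₂⇝ with unpaired one-empty
    where
    unpaired : (I₁′ ≡ [] ⊎ I₃′ ≡ []) →
               ∃[ R ] (length R ≤ 3 × (ofType 1F I₁′ ++ ofType 3F I₃′) ++ ofType 2F I₂′ ⇝ R)
    unpaired (inj₁ refl) = leftover-3 I₃′ I₂′ I₂′≤1
    unpaired (inj₂ refl) rewrite ++-identityʳ (ofType 1F I₁′) = leftover-1 I₁′ I₂′ I₂′≤1
  ...     | R , R≤3 , rest⇝R = R , R≤3 , ↭-⇝ reorder (⇝-++ (ofType0⇝[] I₀) (⇝-trans (⇝-++ I₁₃⇝ I₂⇝) rest⇝R))
    where
    reorder : ofType 0F I₀ ++ (ofType 1F I₁ ++ ofType 3F I₃) ++ ofType 2F I₂ ↭ S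
    reorder = ↭-trans (++⁺ˡ (ofType 0F I₀) (↭-trans (↭-reflexive (++-assoc (ofType 1F I₁) _ _))
                                                     (++⁺ˡ (ofType 1F I₁) (++-comm (ofType 3F I₃) _)))) split

-- The small Davenport constant

module Davenport (q r : ℕ) .{{_ : NonZero q}} (q-prime : Prime q) (q-odd : ¬ 2 ∣ q) (q∣r²+1 : q ∣ r * r + 1) where
  open Congruence q
  open Group q r q∣r²+1
  open OrderFour q-prime q-odd
  open Sequences (mul q r) (one q)
  open SubSeqProperties (mul q r) (one q)
  open Blocks q r q-prime q-odd q∣r²+1
  open Decomposition q r q-prime q-odd q∣r²+1

  long⇒product-one : ∀ S → q + 3 ≤ length S → NonemptyProductOneIn S
  long⇒product-one S q+3≤len =
    let R , R≤3 , bs , bs++R↭S = decompose S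
        T , T⊆bs , 1≤len , T-one = blocks⇒product-one bs (q≤blocks {R} {bs} R≤3 bs++R↭S)
    in T , SubSeq-trans T⊆bs (R , bs++R↭S) , 1≤len , T-one
    where
    q≤blocks : ∀ {R bs} → length R ≤ 3 → concatMap Block.elems bs ++ R ↭ S → q ≤ length (concatMap Block.elems bs)
    q≤blocks {R} {bs} R≤3 bs++R↭S = +-cancelʳ-≤ 3 q _ (begin
      q + 3                                         ≤⟨ q+3≤len ⟩
      length S                                      ≡⟨ ↭-length bs++R↭S ⟨
      length (concatMap Block.elems bs ++ R)        ≡⟨ length-++ (concatMap Block.elems bs) ⟩
      length (concatMap Block.elems bs) + length R  ≤⟨ +-monoʳ-≤ _ R≤3 ⟩
      length (concatMap Block.elems bs) + 3         ∎)
      where open ≤-Reasoning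

  free⇒length≤q+2 : ∀ S → ProductOneFree S → length S ≤ q + 2
  free⇒length≤q+2 S free with length S ≤? q + 2
  ... | yes len≤ = len≤
  ... | no len≰ =
    let T , T⊆S , 0<len , T-one = long⇒product-one S (subst (_≤ length S) (sym (+-suc q 2)) (≰⇒> len≰))
    in ⊥-elim (free T T⊆S 0<len T-one)

  α τ : Elem q
  α = 0F , 1 mod q
  τ = 1F , 0 mod q

  witness : List (Elem q)
  witness = replicate (q ∸ 1) α ++ replicate 3 τ

  length-witness : length witness ≡ q + 2
  length-witness = begin
    length (replicate (q ∸ 1) α ++ replicate 3 τ)  ≡⟨ length-++ (replicate (q ∸ 1) α) ⟩
    length (replicate (q ∸ 1) α) + 3               ≡⟨ cong (_+ 3) (length-replicate (q ∸ 1)) ⟩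
    q ∸ 1 + 3                                      ≡⟨ +-suc (q ∸ 1) 2 ⟩
    suc (q ∸ 1) + 2                                ≡⟨ cong (_+ 2) (suc-pred q) ⟩
    q + 2                                          ∎
    where open ≡-Reasoning

  sum-map-witness : ∀ f → sum (map f witness) ≡ (q ∸ 1) * f α + 3 * f τ
  sum-map-witness f = begin
    sum (map f (replicate (q ∸ 1) α ++ replicate 3 τ))
      ≡⟨ cong sum (map-++ f (replicate (q ∸ 1) α) _) ⟩
    sum (map f (replicate (q ∸ 1) α) ++ map f (replicate 3 τ))
      ≡⟨ sum-++ (map f (replicate (q ∸ 1) α)) _ ⟩
    sum (map f (replicate (q ∸ 1) α)) + sum (map f (replicate 3 τ))
      ≡⟨ cong₂ _+_ (sum-map-replicate (q ∸ 1) α) (sum-map-replicate 3 τ) ⟩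
    (q ∸ 1) * f α + 3 * f τ ∎
    where
    open ≡-Reasoning
    sum-map-replicate : ∀ n x → sum (map f (replicate n x)) ≡ n * f x
    sum-map-replicate zero    x = refl
    sum-map-replicate (suc n) x = cong (f x +_) (sum-map-replicate n x)

  τ-exp-witness : τ-exp witness ≡ 3
  τ-exp-witness = trans (sum-map-witness τ-degree) (cong (_+ 3) (*-zeroʳ (q ∸ 1)))

  -- on lists of α's and τ's, the number of α's
  α-count : List (Elem q) → ℕ
  α-count L = sum (map (λ x → 1 ∸ τ-degree x) L)

  α-count-witness : α-count witness ≡ q ∸ 1
  α-count-witness = trans (sum-map-witness (λ x → 1 ∸ τ-degree x)) (trans (+-identityʳ _) (*-identityʳ (q ∸ 1)))

  AlphaOrTau : Elem q → Set
  AlphaOrTau x = x ≡ α ⊎ x ≡ τ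

  witness-AlphaOrTau : All AlphaOrTau witness
  witness-AlphaOrTau = All.++⁺ (All.replicate⁺ (q ∸ 1) (inj₁ refl)) (All.replicate⁺ 3 (inj₂ refl))

  α-degree-α : α-degree α ≡ 1
  α-degree-α = trans (toℕ-mod 1 q) (m<n⇒m%n≡m 1<q)

  τ-exp≡0⇒all-α : ∀ L → All AlphaOrTau L → τ-exp L ≡ 0 → All (_≡ α) L
  τ-exp≡0⇒all-α []      []               _    = []
  τ-exp≡0⇒all-α (_ ∷ L) (inj₁ refl ∷ αorτ) τ≡0 = refl ∷ τ-exp≡0⇒all-α L αorτ τ≡0
  τ-exp≡0⇒all-α (_ ∷ L) (inj₂ refl ∷ αorτ) ()

  all-α⇒α-exp≡length : ∀ L → All (_≡ α) L → τ-exp L ≡ 0 → α-exp L ≡ length L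
  all-α⇒α-exp≡length []      []          _   = refl
  all-α⇒α-exp≡length (_ ∷ L) (refl ∷ αs) τ≡0 =
    trans (cong₂ (λ a t → a * r ^ t + α-exp L) α-degree-α τ≡0) (cong suc (all-α⇒α-exp≡length L αs τ≡0))

  all-α⇒α-count≡length : ∀ L → All (_≡ α) L → α-count L ≡ length L
  all-α⇒α-count≡length []      []          = refl
  all-α⇒α-count≡length (_ ∷ L) (refl ∷ αs) = cong suc (all-α⇒α-count≡length L αs)

  witness-free : ProductOneFree witness
  witness-free T T⊆w 0<len (L , L↭T , prod≡one) = <⇒≢ 0<len′ (sym len≡0)
    where
    L⊆w : SubSeq L witness
    L⊆w = SubSeq-trans (↭⇒SubSeq L↭T) T⊆w
    τ≤3 : τ-exp L ≤ 3
    τ≤3 = subst (τ-exp L ≤_) τ-exp-witness (SubSeq-sum τ-degree L⊆w)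
    τ≡0 : τ-exp L ≡ 0
    τ≡0 = trans (sym (m<n⇒m%n≡m (s≤s τ≤3))) (proj₁ (prod≡one⇒ L prod≡one))
    all-α : All (_≡ α) L
    all-α = τ-exp≡0⇒all-α L (SubSeq-All witness-AlphaOrTau L⊆w) τ≡0
    len<q : length L < q
    len<q = begin-strict
      length L        ≡⟨ all-α⇒α-count≡length L all-α ⟨
      α-count L       ≤⟨ SubSeq-sum (λ x → 1 ∸ τ-degree x) L⊆w ⟩
      α-count witness ≡⟨ α-count-witness ⟩
      q ∸ 1           <⟨ ≤-reflexive (suc-pred q) ⟩
      q               ∎
      where open ≤-Reasoning
    len≡0 : length L ≡ 0
    len≡0 = ≈⇒≡ len<q (>-nonZero⁻¹ q)
      (subst (_≈ 0) (all-α⇒α-exp≡length L all-α τ≡0) (proj₂ (prod≡one⇒ L prod≡one)))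
    0<len′ : 0 < length L
    0<len′ = subst (0 <_) (sym (↭-length L↭T)) 0<len

theorem6p1 : (q r : ℕ) .{{_ : NonZero q}} → Prime q → ¬ (2 ∣ q) →
    1 ≤ r → r ≤ q ∸ 1 → q ∣ (r * r + 1) →
    Sequences.IsSmallDavenport (mul q r) (one q) (q + 2)
theorem6p1 q r q-prime q-odd _ _ q∣r²+1 = (witness , length-witness , witness-free) , free⇒length≤q+2
  where open Davenport q r q-prime q-odd q∣r²+1
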